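{- Let $\lambda,\nu,\bar\lambda,\bar\nu$ be partitions, let $l=l(\lambda)$, and suppose \[\nu=(\lambda_1,\bar\nu_1+1,\bar\nu_2+1,\dots,\bar\nu_{l-1}+1),\qquad \lambda=(\lambda_1,\bar\lambda_1+1,\bar\lambda_2+1,\dots,\bar\lambda_{l-1}+1),\] where $\bar\nu_i=0$ for $l(\bar\nu)<i<l$. Then for all partitions $\mu$, \[c(\lambda;\mu,\nu)=c(\bar\lambda;\mu,\bar\nu).\]
   Context: $l(\lambda)$ denotes the number of nonzero parts of a partition $\lambda$, and $c(\lambda;\mu,\nu)$ denotes the Littlewood–Richardson coefficient (the coefficient of the Schur function $s_\lambda$ in $s_\mu s_\nu$; it is zero unless $\mu,\nu\subseteq\lambda$ and $|\lambda|=|\mu|+|\nu|$). -}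

module Defs where

open import Data.Nat using (ℕ; zero; suc; _+_; _∸_; _≤_; _≥_; _≤ᵇ_; _<ᵇ_; _≡ᵇ_)
open import Data.Bool using (Bool; true; false; _∧_; if_then_else_)
open import Data.List using (List; []; _∷_; length; map; concatMap; reverse; upTo; inits; drop)
open import Data.Bool.ListAction using (and)
open import Data.List.Relation.Unary.All using (All)
open import Data.List.Relation.Unary.Linked using (Linked)
open import Data.Product using (_×_)

IsPartition : List ℕ → Set
IsPartition xs = All (λ x → 1 ≤ x) xs × Linked _≥_ xs

-- l(λ): number of (nonzero) parts; for a partition as above this is its length.
ℓ : List ℕ → ℕ
ℓ = length

-- 0-indexed part, with value 0 beyond the length (λ_{i+1} = at λ i).
at : List ℕ → ℕ → ℕ
at []       _       = 0
at (x ∷ _)  zero    = x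
at (_ ∷ xs) (suc i) = at xs i

pad : ℕ → List ℕ → List ℕ
pad k xs = map (at xs) (upTo k)

occ : ℕ → List ℕ → ℕ
occ k []       = 0
occ k (x ∷ xs) = if k ≡ᵇ x then suc (occ k xs) else occ k xs

countᵇ : {A : Set} → (A → Bool) → List A → ℕ
countᵇ p []       = 0
countᵇ p (x ∷ xs) = if p x then suc (countᵇ p xs) else countᵇ p xs

_⊆ᵇ_ : List ℕ → List ℕ → Bool
[]       ⊆ᵇ _        = true
(x ∷ xs) ⊆ᵇ []       = (x ≡ᵇ 0) ∧ (xs ⊆ᵇ [])
(x ∷ xs) ⊆ᵇ (y ∷ ys) = (x ≤ᵇ y) ∧ (xs ⊆ᵇ ys)

words : ℕ → ℕ → List (List ℕ)
words m zero    = [] ∷ []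
words m (suc r) = concatMap (λ a → map (a ∷_) (words m r)) (map suc (upTo m))

-- all fillings of the skew diagram λ/μ by {1,…,m}: one list per row of λ,
-- row i holding the entries of columns μ_i+1,…,λ_i from left to right.
fillings : ℕ → List ℕ → List ℕ → List (List (List ℕ))
fillings m []      μ = [] ∷ []
fillings m (x ∷ la) μ =
  concatMap (λ w → map (w ∷_) (fillings m la (drop 1 μ))) (words m (x ∸ at μ 0))

rowOK : List ℕ → Bool
rowOK []           = true
rowOK (x ∷ [])     = true
rowOK (x ∷ y ∷ xs) = (x ≤ᵇ y) ∧ rowOK (y ∷ xs)

-- column strictness between consecutive rows r1 (starting after column m1)
-- and r2 (starting after column m2): cell at column m2+p of r2 lies below
-- a cell of r1 iff m1 ≤ m2+p, and then its entry must be strictly larger.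
colOK : List ℕ → ℕ → List ℕ → ℕ → Bool
colOK r1 m1 r2 m2 =
  and (map (λ p → if m1 ≤ᵇ (m2 + p) then (at r1 ((m2 + p) ∸ m1) <ᵇ at r2 p) else true)
           (upTo (length r2)))

colsOK : List (List ℕ) → List ℕ → Bool
colsOK []              μ = true
colsOK (r ∷ [])        μ = true
colsOK (r1 ∷ r2 ∷ rs)  μ = colOK r1 (at μ 0) r2 (at μ 1) ∧ colsOK (r2 ∷ rs) (drop 1 μ)

-- content of the filling is ν (entries lie in {1,…,ℓ ν} by construction)
contentOK : List ℕ → List ℕ → Bool
contentOK ν w = and (map (λ k → (occ (suc k) w ≡ᵇ at ν k)) (upTo (length ν)))

lattice : ℕ → List ℕ → Bool
lattice m w = and (map (λ p → and (map (λ k → occ (suc (suc k)) p ≤ᵇ occ (suc k) p) (upTo m))) (inits w))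

revReading : List (List ℕ) → List ℕ
revReading T = concatMap reverse T

isLR : List ℕ → List ℕ → List (List ℕ) → Bool
isLR μ ν T = and (map rowOK T) ∧ colsOK T μ ∧ contentOK ν (revReading T)
             ∧ lattice (length ν) (revReading T)

-- Littlewood–Richardson coefficient c(λ;μ,ν) = coefficient of s_λ in s_μ s_ν,
-- given by the Littlewood–Richardson rule: the number of LR tableaux of
-- skew shape λ/μ with content ν (zero unless μ ⊆ λ).
c : List ℕ → List ℕ → List ℕ → ℕ
c la μ ν = if μ ⊆ᵇ la then countᵇ (isLR μ ν) (fillings (length ν) la μ) else 0

{-# OPTIONS --safe #-}
-- Write λ = (a, L₁+1, …, L_n+1) and ν = (a, ν̄₁+1, …, ν̄_n+1), with L the parts of λ̄ padded by zeros.
-- An LR tableau T of shape λ/μ and content ν is rigid: its rows read right to left must satisfy the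
-- lattice condition, so row i holds only letters ≤ i; the content ν_i ≥ 1 then forces, by downward
-- induction, row i ≥ 2 to end with the letter i; and since row 1 holds a − μ₁ ones while column
-- strictness allows at most μ_{i−1} − μ_i ones in row i, the a ones of the content fill all these slots.
-- So row i + 1 of T is μ_i − μ_{i+1} ones, the i-th row of a tableau T̄ of shape λ̄/μ raised by one, and
-- a final i + 1. Conversely every LR tableau T̄ of shape λ̄/μ and content ν̄ lifts this way, and the
-- lattice, column and content conditions transfer in both directions, so both coefficients count the
-- same set.
module Submission where

open import Defs
open import Data.Nat
open import Data.Nat.Properties
open import Data.Bool using (Bool; true; false; if_then_else_; _∧_; T)
open import Data.Bool.Properties using (T-∧; T-≡)
open import Data.Unit using (tt)
open import Data.List hiding (and; or; all; any)
open import Data.Bool.ListAction using (and)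
open import Data.List.Properties using
    (∷-injective; length-map; ++-assoc; ++-identityʳ; reverse-++; length-++; length-replicate; length-applyUpTo;
    map-++; reverse-map; map-∘; map-applyUpTo; map-id-local; map-cong-local; unfold-reverse)
open import Data.List.Relation.Unary.Any using (here; there)
open import Data.List.Relation.Unary.All as All using (All; []; _∷_)
import Data.List.Relation.Unary.All.Properties as AP
open import Data.List.Relation.Unary.Linked as Linked using (Linked; []; [-]; _∷_)
import Data.List.Relation.Unary.Linked.Properties as Linked
open import Data.List.Relation.Unary.Linked.Properties using (Linked⇒All)
open import Data.List.Membership.Propositional using (_∈_)
open import Data.List.Membership.Propositional.Properties using
    (∈-map⁺; ∈-map⁻; ∈-filter⁺; ∈-filter⁻; ∈-upTo⁺; ∈-upTo⁻; ∈-cartesianProductWith⁺; ∈-cartesianProductWith⁻)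
open import Data.List.Membership.Propositional.Properties.WithK using (unique∧set⇒bag)
open import Data.List.Relation.Unary.Unique.Propositional using (Unique; []; _∷_)
import Data.List.Relation.Unary.Unique.Propositional.Properties as Unique
open import Data.List.Relation.Binary.BagAndSetEquality using (∼bag⇒↭)
open import Data.List.Relation.Binary.Permutation.Propositional.Properties using (↭-length)
open import Relation.Binary.PropositionalEquality
open import Relation.Nullary using (yes; no)
open import Relation.Nullary.Decidable using (T?)
open import Data.Product using (∃; _×_; _,_; proj₁; proj₂)
open import Data.Sum using (_⊎_; inj₁; inj₂)
open import Data.Empty
open import Function using (_∘_; _⇔_; mk⇔; Equivalence)

countᵇ≡length-filter : ∀ {A : Set} (p : A → Bool) xs → countᵇ p xs ≡ length (filter (T? ∘ p) xs)
countᵇ≡length-filter p [] = refl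
countᵇ≡length-filter p (x ∷ xs) with p x
... | true = cong suc (countᵇ≡length-filter p xs)
... | false = countᵇ≡length-filter p xs

countᵇ-bijection : ∀ {A B : Set} (p : A → Bool) (q : B → Bool) {xs : List A} {ys : List B}
  (g : B → A) (h : A → B) → Unique xs → Unique ys →
  (∀ {y} → y ∈ ys → T (q y) → g y ∈ xs × T (p (g y)) × h (g y) ≡ y) →
  (∀ {x} → x ∈ xs → T (p x) → h x ∈ ys × T (q (h x)) × g (h x) ≡ x) →
  countᵇ p xs ≡ countᵇ q ys
countᵇ-bijection p q {xs} {ys} g h uxs uys onYs onXs = begin
  countᵇ p xs       ≡⟨ countᵇ≡length-filter p xs ⟩
  length X          ≡⟨ length-map h X ⟨
  length (map h X)  ≡⟨ ↭-length (∼bag⇒↭ (unique∧set⇒bag hX-unique (Unique.filter⁺ (T? ∘ q) uys) hX≈Y)) ⟩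
  length Y          ≡⟨ countᵇ≡length-filter q ys ⟨
  countᵇ q ys       ∎
  where
  open ≡-Reasoning
  X = filter (T? ∘ p) xs
  Y = filter (T? ∘ q) ys
  ghX≡X : map g (map h X) ≡ X
  ghX≡X = trans (sym (map-∘ X)) (map-id-local (All.tabulate λ x∈X →
    let (x∈xs , px) = ∈-filter⁻ (T? ∘ p) x∈X in proj₂ (proj₂ (onXs x∈xs px))))
  hX-unique : Unique (map h X)
  hX-unique = Unique.map⁻ (subst Unique (sym ghX≡X) (Unique.filter⁺ (T? ∘ p) uxs))
  hX≈Y : ∀ {z} → (z ∈ map h X) ⇔ (z ∈ Y)
  hX≈Y = mk⇔
    (λ z∈hX → let (x , x∈X , z≡hx) = ∈-map⁻ h z∈hX ; (x∈xs , px) = ∈-filter⁻ (T? ∘ p) x∈X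
                  (hx∈ys , qhx , _) = onXs x∈xs px in
              subst (_∈ Y) (sym z≡hx) (∈-filter⁺ (T? ∘ q) hx∈ys qhx))
    (λ z∈Y → let (z∈ys , qz) = ∈-filter⁻ (T? ∘ q) z∈Y ; (gz∈xs , pgz , hgz) = onYs z∈ys qz in
             subst (_∈ map h X) hgz (∈-map⁺ h (∈-filter⁺ (T? ∘ p) gz∈xs pgz)))

countᵇ-none : ∀ {A : Set} (p : A → Bool) (xs : List A) → (∀ {x} → x ∈ xs → T (p x) → ⊥) → countᵇ p xs ≡ 0
countᵇ-none p [] none = refl
countᵇ-none p (x ∷ xs) none with p x in px
... | true = ⊥-elim (none (here refl) (subst T (sym px) tt))
... | false = countᵇ-none p xs (none ∘ there)

concatMap-prepend : ∀ {A : Set} (xs : List A) (yss : List (List A)) →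
  concatMap (λ x → map (x ∷_) yss) xs ≡ cartesianProductWith _∷_ xs yss
concatMap-prepend [] yss = refl
concatMap-prepend (x ∷ xs) yss = cong (map (x ∷_) yss ++_) (concatMap-prepend xs yss)

Letter : ℕ → ℕ → Set
Letter m x = 1 ≤ x × x ≤ m

Word : ℕ → ℕ → List ℕ → Set
Word m r w = length w ≡ r × All (Letter m) w

∈-alphabet⁻ : ∀ m {x} → x ∈ map suc (upTo m) → Letter m x
∈-alphabet⁻ m x∈ with ∈-map⁻ suc x∈
... | i , i∈ , refl = s≤s z≤n , ∈-upTo⁻ i∈

∈-alphabet⁺ : ∀ m {x} → Letter m x → x ∈ map suc (upTo m)
∈-alphabet⁺ m {suc x} (_ , x<m) = ∈-map⁺ suc (∈-upTo⁺ x<m)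

∈-words⁻ : ∀ m r {w} → w ∈ words m r → Word m r w
∈-words⁻ m zero (here refl) = refl , []
∈-words⁻ m (suc r) {w} w∈ with ∈-cartesianProductWith⁻ _∷_ (map suc (upTo m)) (words m r)
                                 (subst (w ∈_) (concatMap-prepend (map suc (upTo m)) (words m r)) w∈)
... | x , v , x∈ , v∈ , refl = let (len , letters) = ∈-words⁻ m r v∈ in cong suc len , ∈-alphabet⁻ m x∈ ∷ letters

∈-words⁺ : ∀ m r {w} → Word m r w → w ∈ words m r
∈-words⁺ m zero {[]} (refl , []) = here refl
∈-words⁺ m (suc r) {x ∷ w} (len , x∈ ∷ letters) = subst (x ∷ w ∈_)
    (sym (concatMap-prepend (map suc (upTo m)) (words m r)))
  (∈-cartesianProductWith⁺ _∷_ (∈-alphabet⁺ m x∈) (∈-words⁺ m r (suc-injective len , letters)))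

words-unique : ∀ m r → Unique (words m r)
words-unique m zero = [] ∷ []
words-unique m (suc r) = subst Unique (sym (concatMap-prepend (map suc (upTo m)) (words m r)))
  (Unique.cartesianProductWith⁺ _∷_ ∷-injective (Unique.map⁺ suc-injective (Unique.upTo⁺ m)) (words-unique m r))

data RowWords (m : ℕ) : List ℕ → List ℕ → List (List ℕ) → Set where
  [] : ∀ {μ} → RowWords m [] μ []
  _∷_ : ∀ {x la μ w T} → Word m (x ∸ at μ 0) w → RowWords m la (drop 1 μ) T → RowWords m (x ∷ la) μ (w ∷ T)

∈-fillings⁻ : ∀ m la μ {T} → T ∈ fillings m la μ → RowWords m la μ T
∈-fillings⁻ m [] μ (here refl) = []
∈-fillings⁻ m (x ∷ la) μ {Y} Y∈ with ∈-cartesianProductWith⁻ _∷_ (words m (x ∸ at μ 0)) (fillings m la (drop 1 μ))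
                                       (subst (Y ∈_) (concatMap-prepend (words m (x ∸ at μ 0)) _) Y∈)
... | w , T , w∈ , T∈′ , refl = ∈-words⁻ m _ w∈ ∷ ∈-fillings⁻ m la (drop 1 μ) T∈′

∈-fillings⁺ : ∀ m la μ {T} → RowWords m la μ T → T ∈ fillings m la μ
∈-fillings⁺ m [] μ [] = here refl
∈-fillings⁺ m (x ∷ la) μ {v ∷ Y} (w ∷ Y∈) = subst (v ∷ Y ∈_)
    (sym (concatMap-prepend (words m (x ∸ at μ 0)) (fillings m la (drop 1 μ))))
  (∈-cartesianProductWith⁺ _∷_ (∈-words⁺ m (x ∸ at μ 0) w) (∈-fillings⁺ m la (drop 1 μ) Y∈))

fillings-unique : ∀ m la μ → Unique (fillings m la μ)
fillings-unique m [] μ = [] ∷ []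
fillings-unique m (x ∷ la) μ = subst Unique
    (sym (concatMap-prepend (words m (x ∸ at μ 0)) (fillings m la (drop 1 μ))))
  (Unique.cartesianProductWith⁺ _∷_ ∷-injective (words-unique m (x ∸ at μ 0)) (fillings-unique m la (drop 1 μ)))

T-all-upTo : ∀ (f : ℕ → Bool) n → T (and (map f (upTo n))) ⇔ (∀ k → k < n → T (f k))
T-all-upTo f n = mk⇔ (λ t k k<n → All.lookup (AP.all⁺ f (upTo n) t) (∈-upTo⁺ k<n))
                     (λ h → AP.all⁻ f (All.tabulate (λ k∈ → h _ (∈-upTo⁻ k∈))))

T-if-else-true : ∀ b c → T (if b then c else true) ⇔ (T b → T c)
T-if-else-true true c = mk⇔ (λ t _ → t) (λ f → f tt)
T-if-else-true false c = mk⇔ (λ _ ()) (λ _ → tt)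

rowAt : List (List ℕ) → ℕ → List ℕ
rowAt [] _ = []
rowAt (w ∷ _) zero = w
rowAt (_ ∷ Y) (suc r) = rowAt Y r

at-drop1 : ∀ μ i → at (drop 1 μ) i ≡ at μ (suc i)
at-drop1 [] i = refl
at-drop1 (x ∷ μ) i = refl

StrictlyBelow : List ℕ → ℕ → List ℕ → ℕ → Set
StrictlyBelow r₁ m₁ r₂ m₂ = ∀ p → p < length r₂ → m₁ ≤ m₂ + p → at r₁ (m₂ + p ∸ m₁) < at r₂ p

[]-strictlyBelow : ∀ r₁ m₁ m₂ → StrictlyBelow r₁ m₁ [] m₂
[]-strictlyBelow r₁ m₁ m₂ p ()

T-colOK : ∀ r₁ m₁ r₂ m₂ → T (colOK r₁ m₁ r₂ m₂) ⇔ StrictlyBelow r₁ m₁ r₂ m₂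
T-colOK r₁ m₁ r₂ m₂ = mk⇔
  (λ t p p< m₁≤ → <ᵇ⇒< _ _ (Equivalence.to (T-if-else-true (m₁ ≤ᵇ m₂ + p) _)
                             (Equivalence.to (T-all-upTo check (length r₂)) t p p<) (≤⇒≤ᵇ m₁≤)))
  (λ below → Equivalence.from (T-all-upTo check (length r₂)) λ p p< →
    Equivalence.from (T-if-else-true (m₁ ≤ᵇ m₂ + p) _) (λ m₁≤ → <⇒<ᵇ (below p p< (≤ᵇ⇒≤ m₁ _ m₁≤))))
  where
  check : ℕ → Bool
  check p = if m₁ ≤ᵇ (m₂ + p) then (at r₁ ((m₂ + p) ∸ m₁) <ᵇ at r₂ p) else true

ColumnStrict : List (List ℕ) → List ℕ → Set
ColumnStrict Y μ = ∀ r → StrictlyBelow (rowAt Y r) (at μ r) (rowAt Y (suc r)) (at μ (suc r))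

colsOK⁻ : ∀ Y μ → T (colsOK Y μ) → ColumnStrict Y μ
colsOK⁻ [] μ t r = []-strictlyBelow [] _ _
colsOK⁻ (w ∷ []) μ t zero = []-strictlyBelow w _ _
colsOK⁻ (w ∷ []) μ t (suc r) = []-strictlyBelow [] _ _
colsOK⁻ (r₁ ∷ r₂ ∷ rs) μ t zero = Equivalence.to (T-colOK r₁ _ r₂ _) (proj₁ (Equivalence.to T-∧ t))
colsOK⁻ (r₁ ∷ r₂ ∷ rs) μ t (suc r) =
  subst₂ (λ x y → StrictlyBelow (rowAt (r₂ ∷ rs) r) x (rowAt rs r) y) (at-drop1 μ r) (at-drop1 μ (suc r))
    (colsOK⁻ (r₂ ∷ rs) (drop 1 μ) (proj₂ (Equivalence.to (T-∧ {colOK r₁ (at μ 0) r₂ (at μ 1)}) t)) r)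

colsOK⁺ : ∀ Y μ → ColumnStrict Y μ → T (colsOK Y μ)
colsOK⁺ [] μ strict = tt
colsOK⁺ (w ∷ []) μ strict = tt
colsOK⁺ (r₁ ∷ r₂ ∷ rs) μ strict = Equivalence.from T-∧
  ( Equivalence.from (T-colOK r₁ _ r₂ _) (strict 0)
  , colsOK⁺ (r₂ ∷ rs) (drop 1 μ) λ r →
      subst₂ (λ x y → StrictlyBelow (rowAt (r₂ ∷ rs) r) x (rowAt rs r) y) (sym (at-drop1 μ r))
          (sym (at-drop1 μ (suc r)))
        (strict (suc r)))

HasContent : List ℕ → List ℕ → Set
HasContent ν w = ∀ k → k < length ν → occ (suc k) w ≡ at ν k

T-contentOK : ∀ ν w → T (contentOK ν w) ⇔ HasContent ν w
T-contentOK ν w = mk⇔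
  (λ t k k< → ≡ᵇ⇒≡ _ _ (Equivalence.to (T-all-upTo (λ k → occ (suc k) w ≡ᵇ at ν k) (length ν)) t k k<))
  (λ content → Equivalence.from (T-all-upTo (λ k → occ (suc k) w ≡ᵇ at ν k) (length ν)) λ k k< → ≡⇒≡ᵇ _ _
      (content k k<))

Balanced : ℕ → List ℕ → Set
Balanced m p = ∀ k → k < m → occ (suc (suc k)) p ≤ occ (suc k) p

LatticeWord : ℕ → List ℕ → Set
LatticeWord m w = ∀ p s → p ++ s ≡ w → Balanced m p

∈-inits⁻ : ∀ {A : Set} (w : List A) {p} → p ∈ inits w → ∃ λ s → p ++ s ≡ w
∈-inits⁻ w (here refl) = w , refl
∈-inits⁻ (x ∷ w) (there p∈) with ∈-map⁻ (x ∷_) p∈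
... | p′ , p′∈ , refl = let (s , e) = ∈-inits⁻ w p′∈ in s , cong (x ∷_) e

∈-inits⁺ : ∀ {A : Set} (w : List A) p s → p ++ s ≡ w → p ∈ inits w
∈-inits⁺ w [] s e = here refl
∈-inits⁺ (x ∷ w) (y ∷ p) s refl = there (∈-map⁺ (x ∷_) (∈-inits⁺ w p s refl))

T-lattice : ∀ m w → T (lattice m w) ⇔ LatticeWord m w
T-lattice m w = mk⇔
  (λ t p s e k k< → ≤ᵇ⇒≤ _ _ (Equivalence.to (T-all-upTo (balancedᵇ p) m)
                                (All.lookup (AP.all⁺ (λ p → and (map (balancedᵇ p) (upTo m))) (inits w) t)
                                    (∈-inits⁺ w p s e)) k k<))
  (λ lat → AP.all⁻ (λ p → and (map (balancedᵇ p) (upTo m))) (All.tabulate λ {p} p∈ →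
    let (s , e) = ∈-inits⁻ w p∈ in Equivalence.from (T-all-upTo (balancedᵇ p) m) λ k k< → ≤⇒≤ᵇ (lat p s e k k<)))
  where
  balancedᵇ : List ℕ → ℕ → Bool
  balancedᵇ p k = occ (suc (suc k)) p ≤ᵇ occ (suc k) p

Sorted : List ℕ → Set
Sorted = Linked _≤_

T-rowOK : ∀ w → T (rowOK w) ⇔ Sorted w
T-rowOK w = mk⇔ (to w) (from w)
  where
  to : ∀ w → T (rowOK w) → Sorted w
  to [] t = []
  to (x ∷ []) t = [-]
  to (x ∷ y ∷ w) t = let (x≤y , rest) = Equivalence.to (T-∧ {x ≤ᵇ y}) t in ≤ᵇ⇒≤ x y x≤y ∷ to (y ∷ w) rest
  from : ∀ w → Sorted w → T (rowOK w)
  from [] [] = tt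
  from (x ∷ []) [-] = tt
  from (x ∷ y ∷ w) (x≤y ∷ sorted) = Equivalence.from T-∧ (≤⇒≤ᵇ x≤y , from (y ∷ w) sorted)

record IsLRTableau (μ ν : List ℕ) (Y : List (List ℕ)) : Set where
  field
    rows-sorted : All Sorted Y
    columns-strict : ColumnStrict Y μ
    content : HasContent ν (revReading Y)
    lattice-word : LatticeWord (length ν) (revReading Y)

T-all-rowOK : ∀ Y → T (and (map rowOK Y)) ⇔ All Sorted Y
T-all-rowOK Y = mk⇔ (λ t → All.map (Equivalence.to (T-rowOK _)) (AP.all⁺ rowOK Y t))
                    (λ sorted → AP.all⁻ rowOK (All.map (Equivalence.from (T-rowOK _)) sorted))

T-isLR : ∀ μ ν Y → T (isLR μ ν Y) ⇔ IsLRTableau μ ν Y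
T-isLR μ ν Y = mk⇔
  (λ t → let (rows , t₁) = Equivalence.to (T-∧ {and (map rowOK Y)}) t
             (cols , t₂) = Equivalence.to (T-∧ {colsOK Y μ}) t₁
             (cont , lat) = Equivalence.to (T-∧ {contentOK ν (revReading Y)}) t₂ in
         record { rows-sorted = Equivalence.to (T-all-rowOK Y) rows
                ; columns-strict = colsOK⁻ Y μ cols
                ; content = Equivalence.to (T-contentOK ν (revReading Y)) cont
                ; lattice-word = Equivalence.to (T-lattice (length ν) (revReading Y)) lat })
  (λ lr → Equivalence.from T-∧ (Equivalence.from (T-all-rowOK Y) (IsLRTableau.rows-sorted lr) ,
          Equivalence.from T-∧ (colsOK⁺ Y μ (IsLRTableau.columns-strict lr) ,
          Equivalence.from T-∧ (Equivalence.from (T-contentOK ν (revReading Y)) (IsLRTableau.content lr) ,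
                                Equivalence.from (T-lattice (length ν) (revReading Y))
                                    (IsLRTableau.lattice-word lr)))))

≡ᵇ-refl : ∀ k → (k ≡ᵇ k) ≡ true
≡ᵇ-refl zero = refl
≡ᵇ-refl (suc k) = ≡ᵇ-refl k

occ-∷-≡ : ∀ k xs → occ k (k ∷ xs) ≡ suc (occ k xs)
occ-∷-≡ k xs rewrite ≡ᵇ-refl k = refl

occ-∷-≢ : ∀ {k x} xs → k ≢ x → occ k (x ∷ xs) ≡ occ k xs
occ-∷-≢ {k} {x} xs k≢x with k ≡ᵇ x in eq
... | true = ⊥-elim (k≢x (≡ᵇ⇒≡ k x (subst T (sym eq) tt)))
... | false = refl

occ-++ : ∀ k xs ys → occ k (xs ++ ys) ≡ occ k xs + occ k ys
occ-++ k [] ys = refl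
occ-++ k (x ∷ xs) ys with k ≡ᵇ x
... | true = cong suc (occ-++ k xs ys)
... | false = occ-++ k xs ys

occ-reverse : ∀ k xs → occ k (reverse xs) ≡ occ k xs
occ-reverse k [] = refl
occ-reverse k (x ∷ xs) = begin
  occ k (reverse (x ∷ xs))             ≡⟨ cong (occ k) (unfold-reverse x xs) ⟩
  occ k (reverse xs ++ x ∷ [])         ≡⟨ occ-++ k (reverse xs) (x ∷ []) ⟩
  occ k (reverse xs) + occ k (x ∷ [])  ≡⟨ cong (_+ occ k (x ∷ [])) (occ-reverse k xs) ⟩
  occ k xs + occ k (x ∷ [])            ≡⟨ +-comm (occ k xs) _ ⟩
  occ k (x ∷ []) + occ k xs            ≡⟨ occ-++ k (x ∷ []) xs ⟨
  occ k (x ∷ xs)                       ∎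
  where open ≡-Reasoning

occ-map-suc : ∀ k xs → occ (suc k) (map suc xs) ≡ occ k xs
occ-map-suc k [] = refl
occ-map-suc k (x ∷ xs) with k ≡ᵇ x
... | true = cong suc (occ-map-suc k xs)
... | false = occ-map-suc k xs

occ-≡0 : ∀ k xs → All (k ≢_) xs → occ k xs ≡ 0
occ-≡0 k [] [] = refl
occ-≡0 k (x ∷ xs) (k≢x ∷ k∉xs) = trans (occ-∷-≢ xs k≢x) (occ-≡0 k xs k∉xs)

occ-replicate : ∀ k d x → occ k (replicate d x) ≡ (if k ≡ᵇ x then d else 0)
occ-replicate k zero x with k ≡ᵇ x
... | true = refl
... | false = refl
occ-replicate k (suc d) x with k ≡ᵇ x in eq
... | true = cong suc (trans (occ-replicate k d x) (cong (λ b → if b then d else 0) eq))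
... | false = trans (occ-replicate k d x) (cong (λ b → if b then d else 0) eq)

∈⇒1≤occ : ∀ k xs → k ∈ xs → 1 ≤ occ k xs
∈⇒1≤occ k (x ∷ xs) (here refl) = subst (1 ≤_) (sym (occ-∷-≡ k xs)) (s≤s z≤n)
∈⇒1≤occ k (x ∷ xs) (there k∈) with k ≡ᵇ x
... | true = s≤s z≤n
... | false = ∈⇒1≤occ k xs k∈

1≤occ⇒∈ : ∀ k xs → 1 ≤ occ k xs → k ∈ xs
1≤occ⇒∈ k (x ∷ xs) le with k ≡ᵇ x in eq
... | true = here (≡ᵇ⇒≡ k x (subst T (sym eq) tt))
... | false = there (1≤occ⇒∈ k xs le)

occ≤length : ∀ k w → occ k w ≤ length w
occ≤length k [] = z≤n
occ≤length k (x ∷ w) with k ≡ᵇ x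
... | true = s≤s (occ≤length k w)
... | false = m≤n⇒m≤1+n (occ≤length k w)

concatUpTo : ∀ {A : Set} → (ℕ → List A) → ℕ → List A
concatUpTo F zero = []
concatUpTo F (suc N) = concatUpTo F N ++ F N

concatUpTo-suc : ∀ {A : Set} (F : ℕ → List A) N → concatUpTo F (suc N) ≡ F 0 ++ concatUpTo (F ∘ suc) N
concatUpTo-suc F zero = sym (++-identityʳ (F 0))
concatUpTo-suc F (suc N) = trans (cong (_++ F (suc N)) (concatUpTo-suc F N))
    (++-assoc (F 0) (concatUpTo (F ∘ suc) N) (F (suc N)))

concatMap-applyUpTo : ∀ {A : Set} (F : ℕ → List A) f N → concatMap F (applyUpTo f N) ≡ concatUpTo (F ∘ f) N
concatMap-applyUpTo F f zero = refl
concatMap-applyUpTo F f (suc N) = trans (cong (F (f 0) ++_) (concatMap-applyUpTo F (f ∘ suc) N))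
    (sym (concatUpTo-suc (F ∘ f) N))

concatMap-upTo : ∀ {A : Set} (F : ℕ → List A) N → concatMap F (upTo N) ≡ concatUpTo F N
concatMap-upTo F N = concatMap-applyUpTo F (λ x → x) N

concatMap-rows : ∀ {A : Set} (f : List ℕ → List A) T → concatMap f T ≡ concatUpTo (f ∘ rowAt T) (length T)
concatMap-rows f [] = refl
concatMap-rows f (w ∷ T) = trans (cong (f w ++_) (concatMap-rows f T))
    (sym (concatUpTo-suc (f ∘ rowAt (w ∷ T)) (length T)))

rowAt-applyUpTo : ∀ (f : ℕ → List ℕ) n r → r < n → rowAt (applyUpTo f n) r ≡ f r
rowAt-applyUpTo f (suc n) zero lt = refl
rowAt-applyUpTo f (suc n) (suc r) (s≤s lt) = rowAt-applyUpTo (f ∘ suc) n r lt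

rowAt-applyUpTo-≥ : ∀ (f : ℕ → List ℕ) n r → n ≤ r → rowAt (applyUpTo f n) r ≡ []
rowAt-applyUpTo-≥ f zero r le = refl
rowAt-applyUpTo-≥ f (suc n) (suc r) (s≤s le) = rowAt-applyUpTo-≥ (f ∘ suc) n r le

rowAt-map-upTo : ∀ (f : ℕ → List ℕ) n r → r < n → rowAt (map f (upTo n)) r ≡ f r
rowAt-map-upTo f n r lt = trans (cong (λ L → rowAt L r) (map-applyUpTo (λ x → x) f n))
  (rowAt-applyUpTo f n r lt)

rowAt-map-upTo-≥ : ∀ (f : ℕ → List ℕ) n r → n ≤ r → rowAt (map f (upTo n)) r ≡ []
rowAt-map-upTo-≥ f n r le = trans (cong (λ L → rowAt L r) (map-applyUpTo (λ x → x) f n))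
  (rowAt-applyUpTo-≥ f n r le)

length-map-upTo : ∀ {A : Set} (f : ℕ → A) n → length (map f (upTo n)) ≡ n
length-map-upTo f n = trans (length-map f (upTo n)) (length-applyUpTo (λ x → x) n)

rowAt-≥length : ∀ T r → length T ≤ r → rowAt T r ≡ []
rowAt-≥length [] r le = refl
rowAt-≥length (w ∷ T) (suc r) (s≤s le) = rowAt-≥length T r le

rows-η : ∀ T → T ≡ map (rowAt T) (upTo (length T))
rows-η [] = refl
rows-η (w ∷ T) = cong (w ∷_) (trans (rows-η T)
  (trans (map-applyUpTo (λ x → x) (rowAt T) (length T))
    (sym (map-applyUpTo suc (rowAt (w ∷ T)) (length T)))))

sumUpTo : ℕ → (ℕ → ℕ) → ℕ
sumUpTo zero f = 0
sumUpTo (suc N) f = sumUpTo N f + f N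

occ-concatUpTo : ∀ k F N → occ k (concatUpTo F N) ≡ sumUpTo N (λ i → occ k (F i))
occ-concatUpTo k F zero = refl
occ-concatUpTo k F (suc N) = trans (occ-++ k (concatUpTo F N) (F N)) (cong (_+ occ k (F N)) (occ-concatUpTo k F N))

sumUpTo-cong : ∀ N f g → (∀ i → i < N → f i ≡ g i) → sumUpTo N f ≡ sumUpTo N g
sumUpTo-cong zero f g h = refl
sumUpTo-cong (suc N) f g h = cong₂ _+_ (sumUpTo-cong N f g (λ i lt → h i (m≤n⇒m≤1+n lt))) (h N ≤-refl)

sumUpTo-≡0 : ∀ N f → (∀ i → i < N → f i ≡ 0) → sumUpTo N f ≡ 0
sumUpTo-≡0 zero f h = refl
sumUpTo-≡0 (suc N) f h = cong₂ _+_ (sumUpTo-≡0 N f (λ i lt → h i (m≤n⇒m≤1+n lt))) (h N ≤-refl)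

concatUpTo-split : ∀ {A : Set} (F : ℕ → List A) r N → r < N → ∃ λ rest → concatUpTo F N ≡ concatUpTo F r ++ F r ++
    rest
concatUpTo-split F r (suc N) lt with m≤n⇒m<n∨m≡n (≤-pred lt)
... | inj₂ refl = [] , trans (cong (concatUpTo F r ++_) (sym (++-identityʳ (F r)))) refl
... | inj₁ lt' = let (rest , e) = concatUpTo-split F r N lt' in
  rest ++ F N , trans (cong (_++ F N) e) (trans (++-assoc (concatUpTo F r) (F r ++ rest) (F N))
    (cong (concatUpTo F r ++_) (++-assoc (F r) rest (F N))))

++-≡-++-cases : ∀ {A : Set} (p s u v : List A) → p ++ s ≡ u ++ v →
  (∃ λ t → p ++ t ≡ u) ⊎ (∃ λ p₂ → p ≡ u ++ p₂ × p₂ ++ s ≡ v)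
++-≡-++-cases p s [] v e = inj₂ (p , refl , e)
++-≡-++-cases [] s (x ∷ u) v e = inj₁ (x ∷ u , refl)
++-≡-++-cases (y ∷ p) s (x ∷ u) v e with ∷-injective e
... | refl , e' with ++-≡-++-cases p s u v e'
... | inj₁ (t , e2) = inj₁ (t , cong (x ∷_) e2)
... | inj₂ (p₂ , e2 , e3) = inj₂ (p₂ , cong (x ∷_) e2 , e3)

LatticeAfter : ℕ → List ℕ → List ℕ → Set
LatticeAfter m u w = ∀ p s → p ++ s ≡ w → Balanced m (u ++ p)

latticeAfter-++⁻ : ∀ m u v w → LatticeAfter m u (v ++ w) → LatticeAfter m u v × LatticeAfter m (u ++ v) w
latticeAfter-++⁻ m u v w L = (λ p s e → L p (s ++ w) (trans (sym (++-assoc p s w)) (cong (_++ w) e))) ,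
  (λ p s e → subst (Balanced m) (sym (++-assoc u v p)) (L (v ++ p) s (trans (++-assoc v p s) (cong (v ++_) e))))

latticeAfter-++⁺ : ∀ m u v w → LatticeAfter m u v → LatticeAfter m (u ++ v) w → LatticeAfter m u (v ++ w)
latticeAfter-++⁺ m u v w L1 L2 p s e with ++-≡-++-cases p s v w e
... | inj₁ (t , e2) = L1 p t e2
... | inj₂ (p₂ , refl , e3) = subst (Balanced m) (++-assoc u v p₂) (L2 p₂ s e3)

sorted-head : ∀ {x w} → Sorted (x ∷ w) → All (x ≤_) w
sorted-head s = All.tail (Linked⇒All ≤-trans ≤-refl s)

sorted-++⁻ : ∀ xs {ys} → Sorted (xs ++ ys) → Sorted xs × Sorted ys
sorted-++⁻ [] s = [] , s
sorted-++⁻ (x ∷ []) s = [-] , Linked.tail s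
sorted-++⁻ (x ∷ x′ ∷ xs) (x≤x′ ∷ s) = let (sxs , sys) = sorted-++⁻ (x′ ∷ xs) s in x≤x′ ∷ sxs , sys

sorted-++⁺ : ∀ xs ys b → Sorted xs → Sorted ys → All (_≤ b) xs → All (b ≤_) ys → Sorted (xs ++ ys)
sorted-++⁺ [] ys b _ s _ _ = s
sorted-++⁺ (x ∷ []) [] b _ _ _ _ = [-]
sorted-++⁺ (x ∷ []) (y ∷ ys) b _ s (x≤b ∷ []) (b≤y ∷ _) = ≤-trans x≤b b≤y ∷ s
sorted-++⁺ (x ∷ x′ ∷ xs) ys b (x≤x′ ∷ s₁) s₂ (_ ∷ xs≤b) b≤ys = x≤x′ ∷ sorted-++⁺ (x′ ∷ xs) ys b s₁ s₂ xs≤b b≤ys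

sorted-∷ʳ⁻ : ∀ w y → Sorted (w ++ y ∷ []) → All (_≤ y) w
sorted-∷ʳ⁻ [] y s = []
sorted-∷ʳ⁻ (x ∷ w) y s with AP.++⁻ʳ w (sorted-head s)
... | x≤y ∷ [] = x≤y ∷ sorted-∷ʳ⁻ w y (Linked.tail s)

sorted-map-suc⁻ : ∀ {w} → Sorted (map suc w) → Sorted w
sorted-map-suc⁻ s = Linked.map ≤-pred (Linked.map⁻ s)

sorted-map-suc⁺ : ∀ {w} → Sorted w → Sorted (map suc w)
sorted-map-suc⁺ s = Linked.map⁺ (Linked.map s≤s s)

sorted-replicate : ∀ d x → Sorted (replicate d x)
sorted-replicate zero x = []
sorted-replicate (suc zero) x = [-]
sorted-replicate (suc (suc d)) x = ≤-refl ∷ sorted-replicate (suc d) x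


snoc-view : ∀ {A : Set} (w : List A) → w ≢ [] → ∃ λ w₀ → ∃ λ y → w ≡ w₀ ++ y ∷ []
snoc-view [] ne = ⊥-elim (ne refl)
snoc-view (x ∷ []) ne = [] , x , refl
snoc-view (x ∷ x' ∷ w) ne = let (w₀ , y , e) = snoc-view (x' ∷ w) (λ ()) in x ∷ w₀ , y , cong (x ∷_) e

2≤⇒1≢ : ∀ {x y} → suc (suc x) ≤ y → 1 ≢ y
2≤⇒1≢ (s≤s (s≤s _)) ()

ones-split : ∀ w → Sorted w → All (1 ≤_) w → ∃ λ rest → w ≡ replicate (occ 1 w) 1 ++ rest × All (2 ≤_) rest
ones-split [] s a = [] , refl , []
ones-split (suc zero ∷ w) s (_ ∷ a) = let (rest , e , b) = ones-split w (Linked.tail s) a in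
  rest , cong (1 ∷_) e , b
ones-split (suc (suc x) ∷ w) s (_ ∷ a) = suc (suc x) ∷ w ,
  sym (cong (_++ suc (suc x) ∷ w) (cong (λ k → replicate k 1) (occ-≡0 1 w (All.map 2≤⇒1≢ (sorted-head s))))) ,
  s≤s (s≤s z≤n) ∷ All.map (≤-trans (s≤s (s≤s z≤n))) (sorted-head s)


at-≥length : ∀ (xs : List ℕ) i → length xs ≤ i → at xs i ≡ 0
at-≥length [] i le = refl
at-≥length (x ∷ xs) (suc i) (s≤s le) = at-≥length xs i le

at-applyUpTo : ∀ (f : ℕ → ℕ) N v → v < N → at (applyUpTo f N) v ≡ f v
at-applyUpTo f (suc N) zero lt = refl
at-applyUpTo f (suc N) (suc v) (s≤s lt) = at-applyUpTo (f ∘ suc) N v lt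

at-applyUpTo-≥ : ∀ (f : ℕ → ℕ) N v → N ≤ v → at (applyUpTo f N) v ≡ 0
at-applyUpTo-≥ f zero v le = refl
at-applyUpTo-≥ f (suc N) (suc v) (s≤s le) = at-applyUpTo-≥ (f ∘ suc) N v le

at-++ˡ : ∀ xs ys i → i < length xs → at (xs ++ ys) i ≡ at xs i
at-++ˡ (x ∷ xs) ys zero lt = refl
at-++ˡ (x ∷ xs) ys (suc i) (s≤s lt) = at-++ˡ xs ys i lt

at-++ʳ : ∀ xs ys j → at (xs ++ ys) (length xs + j) ≡ at ys j
at-++ʳ [] ys j = refl
at-++ʳ (x ∷ xs) ys j = at-++ʳ xs ys j

at-replicate : ∀ d x i → i < d → at (replicate d x) i ≡ x
at-replicate (suc d) x zero lt = refl
at-replicate (suc d) x (suc i) (s≤s lt) = at-replicate d x i lt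

at-map-suc : ∀ u i → i < length u → at (map suc u) i ≡ suc (at u i)
at-map-suc (x ∷ u) zero lt = refl
at-map-suc (x ∷ u) (suc i) (s≤s lt) = at-map-suc u i lt

at-≤ : ∀ {c} w i → All (_≤ c) w → at w i ≤ c
at-≤ [] i a = z≤n
at-≤ (x ∷ w) zero (le ∷ a) = le
at-≤ (x ∷ w) (suc i) (le ∷ a) = at-≤ w i a

All-at : ∀ {P : ℕ → Set} w i → All P w → i < length w → P (at w i)
All-at (x ∷ w) zero (p ∷ a) lt = p
All-at (x ∷ w) (suc i) (p ∷ a) (s≤s lt) = All-at w i a lt

liftRow : ℕ → List ℕ → ℕ → List ℕ
liftRow d u c = replicate d 1 ++ map suc u ++ c ∷ []

length-liftRow : ∀ d u c → length (liftRow d u c) ≡ d + suc (length u)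
length-liftRow d u c = trans (length-++ (replicate d 1)) (cong₂ _+_ (length-replicate d)
  (trans (length-++ (map suc u)) (trans (cong (_+ 1) (length-map suc u)) (+-comm (length u) 1))))

at-liftRow-ones : ∀ d u c i → i < d → at (liftRow d u c) i ≡ 1
at-liftRow-ones d u c i lt = trans (at-++ˡ (replicate d 1) _ i (subst (i <_) (sym (length-replicate d)) lt))
    (at-replicate d 1 i lt)

at-liftRow-middle : ∀ d u c q → q < length u → at (liftRow d u c) (d + q) ≡ suc (at u q)
at-liftRow-middle d u c q lt = trans
    (subst (λ z → at (liftRow d u c) (z + q) ≡ at (map suc u ++ c ∷ []) q) (length-replicate d)
    (at-++ʳ (replicate d 1) _ q))
  (trans (at-++ˡ (map suc u) _ q (subst (q <_) (sym (length-map suc u)) lt)) (at-map-suc u q lt))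

at-liftRow-last : ∀ d u c → at (liftRow d u c) (d + length u) ≡ c
at-liftRow-last d u c = trans
    (subst (λ z → at (liftRow d u c) (z + length u) ≡ at (map suc u ++ c ∷ []) (length u)) (length-replicate d)
    (at-++ʳ (replicate d 1) _ (length u)))
  (subst (λ z → at (map suc u ++ c ∷ []) z ≡ c) (trans (+-identityʳ _) (length-map suc u))
      (at-++ʳ (map suc u) (c ∷ []) 0))

liftRow-≤ : ∀ d u c → 1 ≤ c → All (λ x → suc x ≤ c) u → All (_≤ c) (liftRow d u c)
liftRow-≤ d u c one a = AP.++⁺ (AP.replicate⁺ d one)
  (AP.++⁺ (AP.map⁺ a) (≤-refl ∷ []))

liftRow-index : ∀ d (u : List ℕ) i → i < d ⊎ (∃ λ (q : ℕ) → i ≡ d + q × q < length u) ⊎ i ≡ d + length u ⊎ d + suc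
    (length u) ≤ i
liftRow-index d u i with i <? d
... | yes lt = inj₁ lt
... | no nlt with m≤n⇒∃[o]m+o≡n (≮⇒≥ nlt)
... | q , refl with q <? length u
... | yes lt = inj₂ (inj₁ (q , refl , lt))
... | no nlt2 with m≤n⇒m<n∨m≡n (≮⇒≥ nlt2)
... | inj₁ lt = inj₂ (inj₂ (inj₂ (+-monoʳ-≤ d lt)))
... | inj₂ refl = inj₂ (inj₂ (inj₁ refl))

liftRow-strictlyBelow⁻ : ∀ σ d1 d0 c u v → length v ≤ d0 + length u →
  StrictlyBelow (liftRow d0 u c) (σ + d1) (liftRow d1 v (suc c)) σ → StrictlyBelow u (σ + d1 + d0) v (σ + d1)
liftRow-strictlyBelow⁻ σ d1 d0 c u v lenle C p plt le with m≤n⇒∃[o]m+o≡n (+-cancelˡ-≤ (σ + d1) d0 p le)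
... | q , refl = subst (λ z → at u z < at v (d0 + q)) (sym e1) (≤-pred (subst₂ _<_ e3 e4 C0))
  where
  P = d1 + (d0 + q)
  Plt : P < length (liftRow d1 v (suc c))
  Plt = subst (P <_) (sym (length-liftRow d1 v (suc c))) (+-monoʳ-< d1 (<⇒≤ (s≤s plt)))
  cond : σ + d1 ≤ σ + P
  cond = subst (σ + d1 ≤_) (+-assoc σ d1 (d0 + q)) (m≤m+n (σ + d1) (d0 + q))
  C0 = C P Plt cond
  idx : σ + P ∸ (σ + d1) ≡ d0 + q
  idx = trans ([m+n]∸[m+o]≡n∸o σ P d1) (m+n∸m≡n d1 (d0 + q))
  qlt : q < length u
  qlt = +-cancelˡ-< d0 q (length u) (≤-trans plt lenle)
  e3 : at (liftRow d0 u c) (σ + P ∸ (σ + d1)) ≡ suc (at u q)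
  e3 = trans (cong (at (liftRow d0 u c)) idx) (at-liftRow-middle d0 u c q qlt)
  e4 : at (liftRow d1 v (suc c)) P ≡ suc (at v (d0 + q))
  e4 = at-liftRow-middle d1 v (suc c) (d0 + q) plt
  e1 : σ + d1 + (d0 + q) ∸ (σ + d1 + d0) ≡ q
  e1 = trans (cong (_∸ (σ + d1 + d0)) (sym (+-assoc (σ + d1) d0 q))) (m+n∸m≡n (σ + d1 + d0) q)

liftRow-strictlyBelow⁺ : ∀ σ d1 d0 c u v → length v ≤ d0 + length u → 1 ≤ c → All (λ x → suc x ≤ c) u → All (1 ≤_)
    v →
  StrictlyBelow u (σ + d1 + d0) v (σ + d1) → StrictlyBelow (liftRow d0 u c) (σ + d1) (liftRow d1 v (suc c)) σ
liftRow-strictlyBelow⁺ σ d1 d0 c u v lenle one ub vb C P Plt le with m≤n⇒∃[o]m+o≡n (+-cancelˡ-≤ σ d1 P le)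
... | j , refl with liftRow-index d1 v (d1 + j)
... | inj₁ lt = ⊥-elim (m+n≮m d1 j lt)
... | inj₂ (inj₂ (inj₂ ge)) = ⊥-elim
    (<-irrefl refl (≤-trans Plt (subst (_≤ d1 + j) (sym (length-liftRow d1 v (suc c))) ge)))
... | inj₂ (inj₂ (inj₁ e)) = subst₂ _<_ (sym (cong (at (liftRow d0 u c)) idx))
    (sym (trans (cong (at (liftRow d1 v (suc c))) e) (at-liftRow-last d1 v (suc c))))
        (s≤s (at-≤ (liftRow d0 u c) j (liftRow-≤ d0 u c one ub)))
  where
  idx : σ + (d1 + j) ∸ (σ + d1) ≡ j
  idx = trans ([m+n]∸[m+o]≡n∸o σ (d1 + j) d1) (m+n∸m≡n d1 j)
... | inj₂ (inj₁ (q , e , qlt)) with +-cancelˡ-≡ d1 j q e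
... | refl with j <? d0
...   | yes jd0 = subst₂ _<_ (sym (trans (cong (at (liftRow d0 u c)) idx) (at-liftRow-ones d0 u c j jd0)))
          (sym (at-liftRow-middle d1 v (suc c) j qlt)) (s≤s (All-at v j vb qlt))
  where
  idx : σ + (d1 + j) ∸ (σ + d1) ≡ j
  idx = trans ([m+n]∸[m+o]≡n∸o σ (d1 + j) d1) (m+n∸m≡n d1 j)
...   | no njd0 with m≤n⇒∃[o]m+o≡n (≮⇒≥ njd0)
...     | k , refl = subst₂ _<_ (sym (trans (cong (at (liftRow d0 u c)) idx) (at-liftRow-middle d0 u c k klt)))
          (sym (at-liftRow-middle d1 v (suc c) (d0 + k) qlt)) (s≤s (subst (λ z → at u z < at v (d0 + k)) e1 C0))
  where
  idx : σ + (d1 + (d0 + k)) ∸ (σ + d1) ≡ d0 + k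
  idx = trans ([m+n]∸[m+o]≡n∸o σ (d1 + (d0 + k)) d1) (m+n∸m≡n d1 (d0 + k))
  klt : k < length u
  klt = +-cancelˡ-< d0 k (length u) (≤-trans qlt lenle)
  C0 = C (d0 + k) qlt (subst (σ + d1 + d0 ≤_) (+-assoc (σ + d1) d0 k) (m≤m+n (σ + d1 + d0) k))
  e1 : σ + d1 + (d0 + k) ∸ (σ + d1 + d0) ≡ k
  e1 = trans (cong (_∸ (σ + d1 + d0)) (sym (+-assoc (σ + d1) d0 k))) (m+n∸m≡n (σ + d1 + d0) k)

ones-strictlyBelow-liftRow : ∀ σ d1 ee v → suc (length v) ≤ ee → All (1 ≤_) v → StrictlyBelow (replicate ee 1)
    (σ + d1)
    (liftRow d1 v 2) σ
ones-strictlyBelow-liftRow σ d1 ee v lenle vb P Plt le with m≤n⇒∃[o]m+o≡n (+-cancelˡ-≤ σ d1 P le)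
... | j , refl with liftRow-index d1 v (d1 + j)
... | inj₁ lt = ⊥-elim (m+n≮m d1 j lt)
... | inj₂ (inj₂ (inj₂ ge)) = ⊥-elim
    (<-irrefl refl (≤-trans Plt (subst (_≤ d1 + j) (sym (length-liftRow d1 v 2)) ge)))
... | inj₂ (inj₂ (inj₁ e)) = subst₂ _<_ (sym (cong (at (replicate ee 1)) idx))
    (sym (trans (cong (at (liftRow d1 v 2)) e) (at-liftRow-last d1 v 2)))
        (s≤s (at-≤ (replicate ee 1) j (AP.replicate⁺ ee ≤-refl)))
  where
  idx : σ + (d1 + j) ∸ (σ + d1) ≡ j
  idx = trans ([m+n]∸[m+o]≡n∸o σ (d1 + j) d1) (m+n∸m≡n d1 j)
... | inj₂ (inj₁ (q , e , qlt)) with +-cancelˡ-≡ d1 j q e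
... | refl = subst₂ _<_
    (sym (trans (cong (at (replicate ee 1)) idx) (at-replicate ee 1 j (≤-trans qlt (≤-trans (n≤1+n _) lenle)))))
          (sym (at-liftRow-middle d1 v 2 j qlt)) (s≤s (All-at v j vb qlt))
  where
  idx : σ + (d1 + j) ∸ (σ + d1) ≡ j
  idx = trans ([m+n]∸[m+o]≡n∸o σ (d1 + j) d1) (m+n∸m≡n d1 j)

leading-ones-bound : ∀ w0 m0 w m1 o → m1 ≤ m0 → m1 + length w ≤ m0 + length w0 → All (1 ≤_) w0 → o ≤ length w →
  (∀ i → i < o → at w i ≡ 1) → StrictlyBelow w0 m0 w m1 → m1 + o ≤ m0
leading-ones-bound w0 m0 w m1 o m10 lens w0b olen ones C with (m1 + o) ≤? m0
... | yes le = le
... | no nle = ⊥-elim (contra (subst (_< 1) (cong (at w0) idx) (subst (at w0 (m1 + p ∸ m0) <_) (ones p plt) C0)))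
  where
  p = m0 ∸ m1
  m1p : m1 + p ≡ m0
  m1p = m+[n∸m]≡n m10
  plt : p < o
  plt = +-cancelˡ-< m1 p o (subst (_< m1 + o) (sym m1p) (≰⇒> nle))
  C0 = C p (≤-trans plt olen) (subst (_≤ m1 + p) m1p ≤-refl)
  idx : m1 + p ∸ m0 ≡ 0
  idx = trans (cong (_∸ m0) m1p) (n∸n≡0 m0)
  w0ne : 0 < length w0
  w0ne = +-cancelˡ-< m0 0 (length w0) (subst (_≤ m0 + length w0)
    (trans (+-suc m1 p) (trans (cong suc m1p) (trans (sym (+-comm m0 1)) (+-suc m0 0))))
    (≤-trans (+-monoʳ-≤ m1 (≤-trans plt olen)) lens))
  contra : at w0 0 < 1 → ⊥
  contra lt = <-irrefl refl (≤-trans lt (All-at w0 0 w0b w0ne))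


All-rowAt⁻ : ∀ {P : List ℕ → Set} T → All P T → ∀ r → r < length T → P (rowAt T r)
All-rowAt⁻ (w ∷ T) (p ∷ a) zero lt = p
All-rowAt⁻ (w ∷ T) (p ∷ a) (suc r) (s≤s lt) = All-rowAt⁻ T a r lt

All-rowAt⁺ : ∀ {P : List ℕ → Set} T → (∀ r → r < length T → P (rowAt T r)) → All P T
All-rowAt⁺ [] h = []
All-rowAt⁺ (w ∷ T) h = h 0 (s≤s z≤n) ∷ All-rowAt⁺ T (λ r lt → h (suc r) (s≤s lt))

record Filling (m : ℕ) (la μ : List ℕ) (T : List (List ℕ)) : Set where
  field
    len : length T ≡ length la
    rlen : ∀ r → r < length la → length (rowAt T r) ≡ at la r ∸ at μ r
    ent : ∀ r → All (Letter m) (rowAt T r)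

RowWords⇒Filling : ∀ {m la μ T} → RowWords m la μ T → Filling m la μ T
RowWords⇒Filling [] = record { len = refl ; rlen = λ r () ; ent = λ r → [] }
RowWords⇒Filling {m} {x ∷ la} {μ} {w ∷ T} (w∈ ∷ F) = record
  { len = cong suc (Filling.len IH)
  ; rlen = λ { zero lt → proj₁ w∈ ; (suc r) (s≤s lt) → trans (Filling.rlen IH r lt)
      (cong (at la r ∸_) (at-drop1 μ r)) }
  ; ent = λ { zero → proj₂ w∈ ; (suc r) → Filling.ent IH r } }
  where IH = RowWords⇒Filling F

Filling⇒RowWords : ∀ m la μ T → Filling m la μ T → RowWords m la μ T
Filling⇒RowWords m [] μ [] P = []
Filling⇒RowWords m (x ∷ la) μ (w ∷ T) P = (Filling.rlen P 0 (s≤s z≤n) , Filling.ent P 0) ∷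
  Filling⇒RowWords m la (drop 1 μ) T (record
    { len = suc-injective (Filling.len P)
    ; rlen = λ r lt → trans (Filling.rlen P (suc r) (s≤s lt)) (cong (at la r ∸_) (sym (at-drop1 μ r)))
    ; ent = λ r → Filling.ent P (suc r) })

revReading≡concatUpTo : ∀ T → revReading T ≡ concatUpTo (reverse ∘ rowAt T) (length T)
revReading≡concatUpTo T = concatMap-rows reverse T

occ-concatUpTo-≡0 : ∀ v F r → (∀ i → i < r → All (_< v) (F i)) → occ v (concatUpTo F r) ≡ 0
occ-concatUpTo-≡0 v F r h = trans (occ-concatUpTo v F r) (sumUpTo-≡0 r _ (λ i lt →
  occ-≡0 v (F i) (All.map (λ {x} lt' e → <-irrefl (sym e) lt') (h i lt))))

All-reverse : ∀ {P : ℕ → Set} w → All P w → All P (reverse w)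
All-reverse [] a = []
All-reverse (x ∷ w) (p ∷ a) = subst (All _) (sym (reverse-++ (x ∷ []) w)) (AP.++⁺ (All-reverse w a) (p ∷ []))

module LatticeRowBound (m : ℕ) (T : List (List ℕ)) (srt : All Sorted T)
  (alph : ∀ r → All (_≤ m) (rowAt T r)) (lat : LatticeWord m (revReading T)) where

  F = reverse ∘ rowAt T

  -- Read right to left, row r starts with its largest letter y; if y > r + 1 the lattice condition
  -- fails at that letter, since the rows above hold only letters ≤ r < y − 1.
  last-entry-≤ : ∀ r → r < length T → (∀ i → i < r → All (_≤ suc i) (rowAt T i)) →
    ∀ w₀ y → rowAt T r ≡ w₀ ++ y ∷ [] → y ≤ suc r
  last-entry-≤ r rlt above w₀ y row≡ with y ≤? suc r
  ... | yes y≤ = y≤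
  ... | no y≰ = ⊥-elim (n≮0 (subst₂ _≤_ occ-y occ-y-1 (lat p (reverse w₀ ++ rest) p++rest k k<m)))
    where
    k = y ∸ 2
    y≡ : y ≡ suc (suc k)
    y≡ = sym (m+[n∸m]≡n {2} {y} (≤-trans (s≤s (s≤s z≤n)) (≰⇒> y≰)))
    r≤k : r ≤ k
    r≤k = ≤-pred (≤-pred (subst (suc (suc r) ≤_) y≡ (≰⇒> y≰)))
    y≤m : y ≤ m
    y≤m with AP.++⁻ʳ w₀ (subst (All (_≤ m)) row≡ (alph r))
    ... | y≤m ∷ [] = y≤m
    k<m : k < m
    k<m = ≤-trans (n≤1+n (suc k)) (subst (_≤ m) y≡ y≤m)
    rest = proj₁ (concatUpTo-split F r (length T) rlt)
    p = concatUpTo F r ++ y ∷ []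
    p++rest : p ++ (reverse w₀ ++ rest) ≡ revReading T
    p++rest = sym (begin
      revReading T                                    ≡⟨ revReading≡concatUpTo T ⟩
      concatUpTo F (length T)                         ≡⟨ proj₂ (concatUpTo-split F r (length T) rlt) ⟩
      concatUpTo F r ++ reverse (rowAt T r) ++ rest   ≡⟨ cong (λ z → concatUpTo F r ++ reverse z ++ rest) row≡ ⟩
      concatUpTo F r ++ reverse (w₀ ++ y ∷ []) ++ rest
        ≡⟨ cong (λ z → concatUpTo F r ++ z ++ rest) (reverse-++ w₀ (y ∷ [])) ⟩
      concatUpTo F r ++ (y ∷ reverse w₀) ++ rest      ≡⟨ ++-assoc (concatUpTo F r) (y ∷ []) (reverse w₀ ++ rest) ⟨
      p ++ (reverse w₀ ++ rest)                       ∎)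
      where open ≡-Reasoning
    above-small : ∀ i → i < r → All (_< suc k) (F i)
    above-small i i<r = All-reverse (rowAt T i) (All.map (λ le → s≤s (≤-trans le (≤-trans i<r r≤k))) (above i i<r))
    occ-y : occ (suc (suc k)) p ≡ suc (occ (suc (suc k)) (concatUpTo F r))
    occ-y = trans (occ-++ _ (concatUpTo F r) (y ∷ [])) (trans (cong (occ (suc (suc k)) (concatUpTo F r) +_)
      (trans (cong (λ z → occ (suc (suc k)) (z ∷ [])) y≡) (occ-∷-≡ (suc (suc k)) []))) (+-comm _ 1))
    occ-y-1 : occ (suc k) p ≡ 0
    occ-y-1 = trans (occ-++ _ (concatUpTo F r) (y ∷ [])) (cong₂ _+_ (occ-concatUpTo-≡0 (suc k) F r above-small)
      (trans (cong (λ z → occ (suc k) (z ∷ [])) y≡)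
          (occ-∷-≢ {suc k} {suc (suc k)} [] (λ e → <-irrefl e (n<1+n _)))))

  row-entries-≤-step : ∀ r → (∀ i → i < r → All (_≤ suc i) (rowAt T i)) → All (_≤ suc r) (rowAt T r)
  row-entries-≤-step r above with rowAt T r in row≡
  ... | [] = []
  ... | x ∷ xs with snoc-view (x ∷ xs) (λ ())
  ... | w₀ , y , e = subst (All (_≤ suc r)) (sym e)
      (AP.++⁺ (All.map (λ le → ≤-trans le y≤) (sorted-∷ʳ⁻ w₀ y sorted)) (y≤ ∷ []))
    where
    r<length : r < length T
    r<length with r <? length T
    ... | yes r< = r<
    ... | no r≮ with () ← trans (sym row≡) (rowAt-≥length T r (≮⇒≥ r≮))
    sorted : Sorted (w₀ ++ y ∷ [])
    sorted = subst Sorted e (subst Sorted row≡ (All-rowAt⁻ T srt r r<length))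
    y≤ : y ≤ suc r
    y≤ = last-entry-≤ r r<length above w₀ y (trans row≡ e)

  row-entries-≤ : ∀ r → All (_≤ suc r) (rowAt T r)
  row-entries-≤ r = go (suc r) r ≤-refl
    where
    go : ∀ N r → r < N → All (_≤ suc r) (rowAt T r)
    go (suc N) r lt = row-entries-≤-step r (λ i ilt → go N i (≤-trans ilt (≤-pred lt)))


⊆ᵇ⇒≤ : ∀ μ la → T (μ ⊆ᵇ la) → ∀ i → at μ i ≤ at la i
⊆ᵇ⇒≤ [] la t i = z≤n
⊆ᵇ⇒≤ (x ∷ μ) [] t zero = ≤-reflexive (≡ᵇ⇒≡ x 0 (proj₁ (Equivalence.to T-∧ t)))
⊆ᵇ⇒≤ (x ∷ μ) [] t (suc i) = ⊆ᵇ⇒≤ μ [] (proj₂ (Equivalence.to (T-∧ {x ≡ᵇ 0}) t)) i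
⊆ᵇ⇒≤ (x ∷ μ) (y ∷ la) t zero = ≤ᵇ⇒≤ x y (proj₁ (Equivalence.to T-∧ t))
⊆ᵇ⇒≤ (x ∷ μ) (y ∷ la) t (suc i) = ⊆ᵇ⇒≤ μ la (proj₂ (Equivalence.to (T-∧ {x ≤ᵇ y}) t)) i

≤⇒⊆ᵇ : ∀ μ la → (∀ i → at μ i ≤ at la i) → T (μ ⊆ᵇ la)
≤⇒⊆ᵇ [] la μ≤la = tt
≤⇒⊆ᵇ (x ∷ μ) [] μ≤la = Equivalence.from T-∧ (≡⇒≡ᵇ x 0 (n≤0⇒n≡0 (μ≤la 0)) , ≤⇒⊆ᵇ μ [] (μ≤la ∘ suc))
≤⇒⊆ᵇ (x ∷ μ) (y ∷ la) μ≤la = Equivalence.from T-∧ (≤⇒≤ᵇ (μ≤la 0) , ≤⇒⊆ᵇ μ la (μ≤la ∘ suc))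

rowAt-++-nil : ∀ Y k r → rowAt (Y ++ replicate k []) r ≡ rowAt Y r
rowAt-++-nil [] zero r = refl
rowAt-++-nil [] (suc k) zero = refl
rowAt-++-nil [] (suc k) (suc r) = rowAt-++-nil [] k r
rowAt-++-nil (w ∷ Y) k zero = refl
rowAt-++-nil (w ∷ Y) k (suc r) = rowAt-++-nil Y k r

rowAt-take : ∀ k Y r → r < k → rowAt (take k Y) r ≡ rowAt Y r
rowAt-take (suc k) [] r lt = refl
rowAt-take (suc k) (w ∷ Y) zero lt = refl
rowAt-take (suc k) (w ∷ Y) (suc r) (s≤s lt) = rowAt-take k Y r lt

rowAt-take-≥ : ∀ k Y r → k ≤ r → rowAt (take k Y) r ≡ []
rowAt-take-≥ zero Y r le = refl
rowAt-take-≥ (suc k) [] r le = refl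
rowAt-take-≥ (suc k) (w ∷ Y) (suc r) (s≤s le) = rowAt-take-≥ k Y r le

length-take-≤ : ∀ k (Y : List (List ℕ)) → k ≤ length Y → length (take k Y) ≡ k
length-take-≤ zero Y le = refl
length-take-≤ (suc k) (w ∷ Y) (s≤s le) = cong suc (length-take-≤ k Y le)

concatUpTo-cong : ∀ {A : Set} (F F' : ℕ → List A) N → (∀ r → r < N → F r ≡ F' r) → concatUpTo F N ≡ concatUpTo F' N
concatUpTo-cong F F' zero h = refl
concatUpTo-cong F F' (suc N) h = cong₂ _++_ (concatUpTo-cong F F' N (λ r lt → h r (≤-trans lt (n≤1+n N))))
    (h N ≤-refl)

concatUpTo-+-[] : ∀ {A : Set} (F : ℕ → List A) N k → (∀ r → N ≤ r → F r ≡ []) → concatUpTo F (N + k) ≡ concatUpTo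
    F N
concatUpTo-+-[] F N zero h = cong (concatUpTo F) (+-identityʳ N)
concatUpTo-+-[] F N (suc k) h = trans (cong (concatUpTo F) (+-suc N k))
    (trans (cong (concatUpTo F (N + k) ++_) (h (N + k) (m≤m+n N k)))
  (trans (++-identityʳ _) (concatUpTo-+-[] F N k h)))

revReading-cong : ∀ Y Z → (∀ r → rowAt Y r ≡ rowAt Z r) → revReading Y ≡ revReading Z
revReading-cong Y Z e = begin
    revReading Y ≡⟨ revReading≡concatUpTo Y ⟩
    concatUpTo FY (length Y)
      ≡⟨ sym (concatUpTo-+-[] FY (length Y) (length Z) (λ r le → cong reverse (rowAt-≥length Y r le))) ⟩
    concatUpTo FY (length Y + length Z) ≡⟨ concatUpTo-cong FY FZ (length Y + length Z) (λ r _ → cong reverse (e r)) ⟩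
    concatUpTo FZ (length Y + length Z) ≡⟨ cong (concatUpTo FZ) (+-comm (length Y) (length Z)) ⟩
    concatUpTo FZ (length Z + length Y)
      ≡⟨ concatUpTo-+-[] FZ (length Z) (length Y) (λ r le → cong reverse (rowAt-≥length Z r le)) ⟩
    concatUpTo FZ (length Z) ≡⟨ sym (revReading≡concatUpTo Z) ⟩
    revReading Z ∎
  where
  open ≡-Reasoning
  FY = reverse ∘ rowAt Y
  FZ = reverse ∘ rowAt Z

All-Sorted-rowAt⁻ : ∀ Y → All Sorted Y → ∀ r → Sorted (rowAt Y r)
All-Sorted-rowAt⁻ [] [] r = []
All-Sorted-rowAt⁻ (w ∷ Y) (p ∷ a) zero = p
All-Sorted-rowAt⁻ (w ∷ Y) (p ∷ a) (suc r) = All-Sorted-rowAt⁻ Y a r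

All-Sorted-rowAt⁺ : ∀ Y → (∀ r → Sorted (rowAt Y r)) → All Sorted Y
All-Sorted-rowAt⁺ [] h = []
All-Sorted-rowAt⁺ (w ∷ Y) h = h 0 ∷ All-Sorted-rowAt⁺ Y (λ r → h (suc r))

IsLRTableau-cong : ∀ μ ν Y Z → (∀ r → rowAt Y r ≡ rowAt Z r) → IsLRTableau μ ν Y → IsLRTableau μ ν Z
IsLRTableau-cong μ ν Y Z e R = record
  { rows-sorted = All-Sorted-rowAt⁺ Z
      (λ r → subst Sorted (e r) (All-Sorted-rowAt⁻ Y (IsLRTableau.rows-sorted R) r))
  ; columns-strict = λ r → subst₂ (λ x y → StrictlyBelow x (at μ r) y (at μ (suc r))) (e r) (e (suc r))
      (IsLRTableau.columns-strict R r)
  ; content = subst (HasContent ν) (revReading-cong Y Z e) (IsLRTableau.content R)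
  ; lattice-word = subst (LatticeWord (length ν)) (revReading-cong Y Z e) (IsLRTableau.lattice-word R) }

map-upTo-cong : ∀ {A : Set} (f f' : ℕ → A) N → (∀ r → r < N → f r ≡ f' r) → map f (upTo N) ≡ map f' (upTo N)
map-upTo-cong f f' N agree = map-cong-local (All.tabulate (λ r∈ → agree _ (∈-upTo⁻ r∈)))

drop-++ : ∀ {A : Set} (xs ys : List A) → drop (length xs) (xs ++ ys) ≡ ys
drop-++ [] ys = refl
drop-++ (x ∷ xs) ys = drop-++ xs ys

take-++ : ∀ {A : Set} (xs ys : List A) → take (length xs) (xs ++ ys) ≡ xs
take-++ [] ys = refl
take-++ (x ∷ xs) ys = cong (x ∷_) (take-++ xs ys)

map-pred-suc : ∀ u → map pred (map suc u) ≡ u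
map-pred-suc [] = refl
map-pred-suc (x ∷ u) = cong (x ∷_) (map-pred-suc u)

replicate-∷ʳ : ∀ k (x : ℕ) → replicate k x ++ x ∷ [] ≡ x ∷ replicate k x
replicate-∷ʳ zero x = refl
replicate-∷ʳ (suc k) x = cong (x ∷_) (replicate-∷ʳ k x)

reverse-replicate : ∀ k (x : ℕ) → reverse (replicate k x) ≡ replicate k x
reverse-replicate zero x = refl
reverse-replicate (suc k) x = trans (reverse-++ (x ∷ []) (replicate k x))
    (trans (cong (_++ x ∷ []) (reverse-replicate k x)) (replicate-∷ʳ k x))

prefix-map-suc : ∀ (p t u : List ℕ) → p ++ t ≡ map suc u → ∃ λ q → ∃ λ t' → p ≡ map suc q × q ++ t' ≡ u
prefix-map-suc [] t u e = [] , u , refl , refl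
prefix-map-suc (x ∷ p) t (y ∷ u) e with ∷-injective e
... | refl , e2 with prefix-map-suc p t u e2
... | q , t' , refl , refl = y ∷ q , t' , refl , refl

balanced-++-ones : ∀ m p p₂ → All (_≡ 1) p₂ → Balanced m p → Balanced m (p ++ p₂)
balanced-++-ones m p p₂ o G k lt = subst₂ _≤_
    (sym (trans (occ-++ _ p p₂) (trans (cong (occ (suc (suc k)) p +_) z) (+-identityʳ _))))
    (sym (occ-++ _ p p₂)) (≤-trans (G k lt) (m≤m+n _ _))
  where
  z : occ (suc (suc k)) p₂ ≡ 0
  z = occ-≡0 _ p₂ (All.map (λ { refl () }) o)

balanced-ones : ∀ m p → All (_≡ 1) p → Balanced m p
balanced-ones m p o k lt = subst (_≤ occ (suc k) p) (sym (occ-≡0 _ p (All.map (λ { refl () }) o))) z≤n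

All-prefix : ∀ {P : ℕ → Set} q t u → q ++ t ≡ u → All P u → All P q
All-prefix q t u refl A = AP.++⁻ˡ q A

all≡1⇒replicate : ∀ w → All (_≡ 1) w → w ≡ replicate (length w) 1
all≡1⇒replicate [] [] = refl
all≡1⇒replicate (x ∷ w) (refl ∷ a) = cong (1 ∷_) (all≡1⇒replicate w a)

map-suc-pred : ∀ w → All (1 ≤_) w → map suc (map pred w) ≡ w
map-suc-pred [] [] = refl
map-suc-pred (suc x ∷ w) (_ ∷ a) = cong (suc x ∷_) (map-suc-pred w a)

All-zip : ∀ {P Q R : ℕ → Set} {w} → All P w → All Q w → (∀ {x} → P x → Q x → R x) → All R w
All-zip [] [] f = []
All-zip (p ∷ a) (q ∷ b) f = f p q ∷ All-zip a b f

rows-∷ : ∀ T N → length T ≡ suc N → T ≡ rowAt T 0 ∷ map (λ r → rowAt T (suc r)) (upTo N)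
rows-∷ (w ∷ T₁) N e = cong (w ∷_) (trans (subst (λ z → T₁ ≡ map (rowAt T₁) (upTo z)) (suc-injective e) (rows-η T₁))
  (map-upTo-cong _ _ N (λ r _ → refl)))

occ≤occ-concatUpTo : ∀ k (F : ℕ → List ℕ) r N → r < N → occ k (F r) ≤ occ k (concatUpTo F N)
occ≤occ-concatUpTo k F r N lt with concatUpTo-split F r N lt
... | rest , e = subst (occ k (F r) ≤_)
    (sym (trans (cong (occ k) e)
    (trans (occ-++ k (concatUpTo F r) _) (cong (occ k (concatUpTo F r) +_) (occ-++ k (F r) rest)))))
  (≤-trans (m≤m+n (occ k (F r)) (occ k rest)) (m≤n+m _ (occ k (concatUpTo F r))))

telescope-bound : ∀ (s f : ℕ → ℕ) N → (∀ r → r < N → f r + s (suc r) ≤ s r) → sumUpTo N f + s N ≤ s 0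
telescope-bound s f zero step = ≤-refl
telescope-bound s f (suc N) step = begin
  sumUpTo N f + f N + s (suc N)    ≡⟨ +-assoc (sumUpTo N f) (f N) (s (suc N)) ⟩
  sumUpTo N f + (f N + s (suc N))  ≤⟨ +-monoʳ-≤ (sumUpTo N f) (step N ≤-refl) ⟩
  sumUpTo N f + s N                ≤⟨ telescope-bound s f N (λ r r<N → step r (m≤n⇒m≤1+n r<N)) ⟩
  s 0                              ∎
  where open ≤-Reasoning

telescope-tight : ∀ (s f : ℕ → ℕ) N → (∀ r → r < N → f r + s (suc r) ≤ s r) → s 0 ≤ sumUpTo N f + s N →
  ∀ r → r < N → f r + s (suc r) ≡ s r
telescope-tight s f (suc N) step total r r<1+N with m≤n⇒m<n∨m≡n (≤-pred r<1+N)
... | inj₁ r<N = telescope-tight s f N step′ (subst (s 0 ≤_) (cong (sumUpTo N f +_) last-tight) total′) r r<N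
  where
  step′ : ∀ r → r < N → f r + s (suc r) ≤ s r
  step′ r r<N = step r (m≤n⇒m≤1+n r<N)
  total′ : s 0 ≤ sumUpTo N f + (f N + s (suc N))
  total′ = subst (s 0 ≤_) (+-assoc (sumUpTo N f) (f N) (s (suc N))) total
  last-tight : f N + s (suc N) ≡ s N
  last-tight = ≤-antisym (step N ≤-refl)
    (+-cancelˡ-≤ (sumUpTo N f) _ _ (≤-trans (telescope-bound s f N step′) total′))
... | inj₂ refl = ≤-antisym (step N ≤-refl)
  (+-cancelˡ-≤ (sumUpTo N f) _ _ (≤-trans (telescope-bound s f N (λ r r<N → step r (m≤n⇒m≤1+n r<N)))
    (subst (s 0 ≤_) (+-assoc (sumUpTo N f) (f N) (s (suc N))) total)))

length≡0⇒[] : ∀ {A : Set} (w : List A) → length w ≡ 0 → w ≡ []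
length≡0⇒[] [] e = refl

∸-telescope : ∀ {x y z} → z ≤ y → y ≤ x → (x ∸ y) + (y ∸ z) ≡ x ∸ z
∸-telescope {x} {y} {z} zy yx = +-cancelʳ-≡ z _ _ (trans (+-assoc (x ∸ y) (y ∸ z) z)
  (trans (cong ((x ∸ y) +_) (m∸n+n≡m zy)) (trans (m∸n+n≡m yx) (sym (m∸n+n≡m (≤-trans zy yx))))))

strictlyBelow-cong : ∀ w0 w {m0 m0' m1 m1'} → m0 ≡ m0' → m1 ≡ m1' → StrictlyBelow w0 m0 w m1 → StrictlyBelow w0
    m0' w
    m1'
strictlyBelow-cong w0 w refl refl c = c

occ-0-positive : ∀ u → All (1 ≤_) u → occ 0 u ≡ 0
occ-0-positive u p = occ-≡0 0 u (All.map (λ { (s≤s _) () }) p)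

occ-singleton-≡ : ∀ v → occ (suc (suc v)) (suc (suc v) ∷ []) ≡ 1
occ-singleton-≡ v = occ-∷-≡ (suc (suc v)) []

occ-singleton-≢ : ∀ v r → v ≢ r → occ (suc (suc v)) (suc (suc r) ∷ []) ≡ 0
occ-singleton-≢ v r ne = occ-∷-≢ {suc (suc v)} {suc (suc r)} [] (λ e → ne (suc-injective (suc-injective e)))

occ-mark-∷ : ∀ v r q → occ (suc (suc v)) (suc (suc r) ∷ map suc q) ≡ occ (suc (suc v)) (suc (suc r) ∷ []) + occ
    (suc v) q
occ-mark-∷ v r q = trans (occ-++ _ (suc (suc r) ∷ []) (map suc q))
    (cong (occ (suc (suc v)) (suc (suc r) ∷ []) +_) (occ-map-suc (suc v) q))

occ-row-bounded : ∀ r q v → All (_≤ suc r) q → r < v → occ (suc v) q ≡ 0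
occ-row-bounded r q v qb lt = occ-≡0 (suc v) q (All.map (λ x≤ e → <-irrefl (sym e) (s≤s (≤-trans x≤ lt))) qb)

reverse-liftRow : ∀ dd u c → reverse (liftRow dd u c) ≡ c ∷ (map suc (reverse u) ++ replicate dd 1)
reverse-liftRow dd u c = trans (reverse-++ (replicate dd 1) (map suc u ++ c ∷ []))
  (cong₂ _++_ (trans (reverse-++ (map suc u) (c ∷ [])) (cong (c ∷_) (sym (reverse-map suc u))))
      (reverse-replicate dd 1))

occ-1-liftRow : ∀ dd u c → All (1 ≤_) u → occ 1 (liftRow dd u (suc (suc c))) ≡ dd
occ-1-liftRow dd u c p = trans (occ-++ 1 (replicate dd 1) _) (trans (cong₂ _+_ (occ-replicate 1 dd 1)
  (trans (occ-++ 1 (map suc u) _) (trans (cong (_+ 0) (trans (occ-map-suc 0 u) (occ-0-positive u p))) refl)))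
      (+-identityʳ dd))

occ-liftRow : ∀ v dd u c → occ (suc (suc v)) (liftRow dd u c) ≡ occ (suc v) u + occ (suc (suc v)) (c ∷ [])
occ-liftRow v dd u c = trans (occ-++ _ (replicate dd 1) _)
    (trans (cong (_+ occ (suc (suc v)) (map suc u ++ c ∷ [])) (trans (occ-replicate _ dd 1) (lem v)))
  (trans (occ-++ _ (map suc u) (c ∷ [])) (cong (_+ occ (suc (suc v)) (c ∷ [])) (occ-map-suc (suc v) u))))
  where
  lem : ∀ v → (if suc (suc v) ≡ᵇ 1 then dd else 0) ≡ 0
  lem v = refl

liftRow-sorted⁺ : ∀ dd u c → 1 ≤ c → Sorted u → All (λ x → suc x ≤ c) u → Sorted (liftRow dd u c)
liftRow-sorted⁺ dd u c one su ub = sorted-++⁺ (replicate dd 1) (map suc u ++ c ∷ []) 1 (sorted-replicate dd 1)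
  (sorted-++⁺ (map suc u) (c ∷ []) c (sorted-map-suc⁺ su) [-] (AP.map⁺ ub) (≤-refl ∷ []))
  (AP.replicate⁺ dd ≤-refl) (AP.++⁺ (AP.map⁺ (All.map (λ _ → s≤s z≤n) ub)) (one ∷ []))

liftRow-sorted⁻ : ∀ dd u c → Sorted (liftRow dd u c) → Sorted u
liftRow-sorted⁻ dd u c st = sorted-map-suc⁻
    (proj₁ (sorted-++⁻ (map suc u) (proj₂ (sorted-++⁻ (replicate dd 1) st))))

-- Rows are indexed from 0: a small tableau has the n rows of L/μ (padded with empty rows), and its
-- lift has the n + 1 rows of (a ∷ map suc L)/μ.
module Lifting (n a : ℕ) (L μ : List ℕ)
  (length-L : length L ≡ n)
  (μ-decreasing : ∀ i → at μ (suc i) ≤ at μ i)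
  (L-decreasing : ∀ i → at L (suc i) ≤ at L i)
  (L[0]<a : suc (at L 0) ≤ a) where

  s : ℕ → ℕ
  s = at μ

  d : ℕ → ℕ
  d r = s r ∸ s (suc r)

  liftedRow : List (List ℕ) → ℕ → List ℕ
  liftedRow T' r = liftRow (d r) (rowAt T' r) (suc (suc r))

  lift : List (List ℕ) → List (List ℕ)
  lift T' = replicate (a ∸ s 0) 1 ∷ map (liftedRow T') (upTo n)

  unliftRow : ℕ → List ℕ → List ℕ
  unliftRow r w = map pred (take (length w ∸ d r ∸ 1) (drop (d r) w))

  unlift : List (List ℕ) → List (List ℕ)
  unlift T = map (λ r → unliftRow r (rowAt T (suc r))) (upTo n)

  μ⊆L : Set
  μ⊆L = ∀ i → s i ≤ at L i

  record SmallFilling (m' : ℕ) (T' : List (List ℕ)) : Set where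
    field
      len : length T' ≡ n
      rlen : ∀ r → r < n → length (rowAt T' r) ≡ at L r ∸ s r
      pos : ∀ r → All (1 ≤_) (rowAt T' r)
      rb : ∀ r → All (_≤ suc r) (rowAt T' r)
      alph : ∀ r → All (_≤ m') (rowAt T' r)

  μ-antitone : ∀ {i j} → i ≤ j → s j ≤ s i
  μ-antitone {i} {j} le with m≤n⇒∃[o]m+o≡n le
  ... | k , refl = go i k
    where
    go : ∀ i k → s (i + k) ≤ s i
    go i zero = subst (λ z → s z ≤ s i) (sym (+-identityʳ i)) ≤-refl
    go i (suc k) = subst (λ z → s z ≤ s i) (sym (+-suc i k)) (≤-trans (μ-decreasing (i + k)) (go i k))

  L[n]≡0 : at L n ≡ 0
  L[n]≡0 = at-≥length L n (subst (_≤ n) (sym length-L) ≤-refl)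

  μ[n]≡0 : μ⊆L → s n ≡ 0
  μ[n]≡0 sub = n≤0⇒n≡0 (subst (s n ≤_) L[n]≡0 (sub n))

  μ[0]≤a : μ⊆L → s 0 ≤ a
  μ[0]≤a sub = ≤-trans (sub 0) (≤-trans (n≤1+n _) L[0]<a)

  μ-split : ∀ r → s r ≡ s (suc r) + d r
  μ-split r = sym (m+[n∸m]≡n (μ-decreasing r))

  rowAt-lift : ∀ T' r → r < n → rowAt (lift T') (suc r) ≡ liftedRow T' r
  rowAt-lift T' r lt = rowAt-map-upTo (liftedRow T') n r lt

  rowAt-lift-≥ : ∀ T' r → n ≤ r → rowAt (lift T') (suc r) ≡ []
  rowAt-lift-≥ T' r le = rowAt-map-upTo-≥ (liftedRow T') n r le

  length-lift : ∀ T' → length (lift T') ≡ suc n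
  length-lift T' = cong suc (length-map-upTo (liftedRow T') n)

  unliftRow-liftRow : ∀ r u c → unliftRow r (liftRow (d r) u c) ≡ u
  unliftRow-liftRow r u c = begin
      map pred (take (length (liftRow (d r) u c) ∸ d r ∸ 1) (drop (d r) (liftRow (d r) u c)))
        ≡⟨ cong₂ (λ x y → map pred (take x y)) e1 e2 ⟩
      map pred (take (length (map suc u)) (map suc u ++ c ∷ [])) ≡⟨ cong (map pred) (take-++ (map suc u) (c ∷ [])) ⟩
      map pred (map suc u) ≡⟨ map-pred-suc u ⟩
      u ∎
    where
    open ≡-Reasoning
    e1 : length (liftRow (d r) u c) ∸ d r ∸ 1 ≡ length (map suc u)
    e1 = trans (cong (λ z → z ∸ d r ∸ 1) (length-liftRow (d r) u c))
        (trans (cong (_∸ 1) (m+n∸m≡n (d r) (suc (length u)))) (sym (length-map suc u)))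
    e2 : drop (d r) (liftRow (d r) u c) ≡ map suc u ++ c ∷ []
    e2 = subst (λ z → drop z (liftRow (d r) u c) ≡ map suc u ++ c ∷ []) (length-replicate (d r))
        (drop-++ (replicate (d r) 1) _)

  unlift-lift : ∀ {m'} T' → SmallFilling m' T' → unlift (lift T') ≡ T'
  unlift-lift T' V = trans
      (map-upTo-cong _ (rowAt T') n
      (λ r lt → trans (cong (unliftRow r) (rowAt-lift T' r lt)) (unliftRow-liftRow r (rowAt T' r) _)))
    (sym (subst (λ z → T' ≡ map (rowAt T') (upTo z)) (SmallFilling.len V) (rows-η T')))

  lift-sorted⁻ : ∀ {m'} T' → SmallFilling m' T' → All Sorted (lift T') → All Sorted T'
  lift-sorted⁻ T' V (_ ∷ A) = All-rowAt⁺ T' (λ r lt →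
    let lt' = subst (r <_) (SmallFilling.len V) lt in
    liftRow-sorted⁻ (d r) (rowAt T' r) _ (subst Sorted (rowAt-lift T' r lt')
      (All-rowAt⁻ (map (liftedRow T') (upTo n)) A r (subst (r <_) (sym (length-map-upTo (liftedRow T') n)) lt'))))

  lift-sorted⁺ : ∀ {m'} T' → SmallFilling m' T' → All Sorted T' → All Sorted (lift T')
  lift-sorted⁺ T' V A = sorted-replicate (a ∸ s 0) 1 ∷ All-rowAt⁺ (map (liftedRow T') (upTo n)) (λ r lt →
    let lt' = subst (r <_) (length-map-upTo (liftedRow T') n) lt in
    subst Sorted (sym (rowAt-lift T' r lt')) (liftRow-sorted⁺ (d r) (rowAt T' r) (suc (suc r)) (s≤s z≤n)
       (All-rowAt⁻ T' A r (subst (r <_) (sym (SmallFilling.len V)) lt')) (All.map s≤s (SmallFilling.rb V r))))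

  μ-split₂ : ∀ r → s r ≡ s (suc (suc r)) + d (suc r) + d r
  μ-split₂ r = trans (μ-split r) (cong (_+ d r) (μ-split (suc r)))

  row-length-step : ∀ {m'} T' → SmallFilling m' T' → μ⊆L → ∀ r → suc r < n →
    length (rowAt T' (suc r)) ≤ d r + length (rowAt T' r)
  row-length-step T' V sub r lt = subst₂ _≤_ (sym (SmallFilling.rlen V (suc r) lt)) (sym e)
      (∸-monoˡ-≤ (s (suc r)) (L-decreasing r))
    where
    e : d r + length (rowAt T' r) ≡ at L r ∸ s (suc r)
    e = trans (cong (d r +_) (SmallFilling.rlen V r (≤-trans (n≤1+n _) lt)))
        (trans (+-comm (d r) _) (∸-telescope (μ-decreasing r) (sub r)))

  lift-columnStrict⁻ : ∀ {m'} T' → SmallFilling m' T' → μ⊆L → ColumnStrict (lift T') μ → ColumnStrict T' μ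
  lift-columnStrict⁻ T' V sub C r with suc r <? n
  ... | no nlt = subst (λ z → StrictlyBelow (rowAt T' r) (s r) z (s (suc r)))
      (sym (rowAt-≥length T' (suc r) (subst (_≤ suc r) (sym (SmallFilling.len V)) (≮⇒≥ nlt))))
      ([]-strictlyBelow (rowAt T' r) _ _)
  ... | yes lt = strictlyBelow-cong (rowAt T' r) (rowAt T' (suc r)) (sym (μ-split₂ r)) (sym (μ-split (suc r)))
      (liftRow-strictlyBelow⁻ (s (suc (suc r))) (d (suc r)) (d r) (suc (suc r)) (rowAt T' r) (rowAt T' (suc r))
          (row-length-step T' V sub r lt)
        (strictlyBelow-cong (liftedRow T' r) (liftedRow T' (suc r)) (μ-split (suc r)) refl
          (subst₂ (λ x y → StrictlyBelow x (s (suc r)) y (s (suc (suc r))))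
              (rowAt-lift T' r (≤-trans (n≤1+n _) lt))
              (rowAt-lift T' (suc r) lt) (C (suc r)))))

  lift-columnStrict⁺ : ∀ {m'} T' → SmallFilling m' T' → μ⊆L → ColumnStrict T' μ → ColumnStrict (lift T') μ
  lift-columnStrict⁺ T' V sub C zero with 0 <? n
  ... | no nlt = subst (λ z → StrictlyBelow (rowAt (lift T') 0) (s 0) z (s 1)) (sym (rowAt-lift-≥ T' 0 (≮⇒≥ nlt)))
      ([]-strictlyBelow (rowAt (lift T') 0) _ _)
  ... | yes lt = subst (λ z → StrictlyBelow (rowAt (lift T') 0) (s 0) z (s 1)) (sym (rowAt-lift T' 0 lt))
      (strictlyBelow-cong (replicate (a ∸ s 0) 1) (liftedRow T' 0) (sym (μ-split 0)) refl
        (ones-strictlyBelow-liftRow (s 1) (d 0) (a ∸ s 0) (rowAt T' 0) lenle (SmallFilling.pos V 0)))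
    where
    lenle : suc (length (rowAt T' 0)) ≤ a ∸ s 0
    lenle = subst (λ z → suc z ≤ a ∸ s 0) (sym (SmallFilling.rlen V 0 lt))
      (subst (_≤ a ∸ s 0) (+-∸-assoc 1 (sub 0)) (∸-monoˡ-≤ (s 0) L[0]<a))
  lift-columnStrict⁺ T' V sub C (suc r) with suc r <? n
  ... | no nlt = subst (λ z → StrictlyBelow (rowAt (lift T') (suc r)) (s (suc r)) z (s (suc (suc r))))
      (sym (rowAt-lift-≥ T' (suc r) (≮⇒≥ nlt)))
      ([]-strictlyBelow (rowAt (lift T') (suc r)) _ _)
  ... | yes lt = subst₂ (λ x y → StrictlyBelow x (s (suc r)) y (s (suc (suc r))))
      (sym (rowAt-lift T' r (≤-trans (n≤1+n _) lt))) (sym (rowAt-lift T' (suc r) lt))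
      (strictlyBelow-cong (liftedRow T' r) (liftedRow T' (suc r)) (sym (μ-split (suc r))) refl
        (liftRow-strictlyBelow⁺ (s (suc (suc r))) (d (suc r)) (d r) (suc (suc r)) (rowAt T' r) (rowAt T' (suc r))
            (row-length-step T' V sub r lt)
          (s≤s z≤n) (All.map s≤s (SmallFilling.rb V r)) (SmallFilling.pos V (suc r))
          (strictlyBelow-cong (rowAt T' r) (rowAt T' (suc r)) (μ-split₂ r) (μ-split (suc r)) (C r))))

  block : List (List ℕ) → ℕ → List ℕ
  block T' r = reverse (liftedRow T' r)

  liftedReading : List (List ℕ) → ℕ → List ℕ
  liftedReading T' r = replicate (a ∸ s 0) 1 ++ concatUpTo (block T') r

  reading : List (List ℕ) → ℕ → List ℕ
  reading T' r = concatUpTo (reverse ∘ rowAt T') r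

  revReading-lift : ∀ T' → revReading (lift T') ≡ liftedReading T' n
  revReading-lift T' = cong₂ _++_ (reverse-replicate (a ∸ s 0) 1)
    (trans (cong concat (sym (map-∘ (upTo n)))) (concatMap-upTo (reverse ∘ liftedRow T') n))

  revReading-small : ∀ {m'} T' → SmallFilling m' T' → revReading T' ≡ reading T' n
  revReading-small T' V = trans (revReading≡concatUpTo T')
      (cong (concatUpTo (reverse ∘ rowAt T')) (SmallFilling.len V))

  occ-1-block : ∀ {m'} T' → SmallFilling m' T' → ∀ r → occ 1 (block T' r) ≡ d r
  occ-1-block T' V r = trans (occ-reverse 1 (liftedRow T' r))
      (occ-1-liftRow (d r) (rowAt T' r) r (SmallFilling.pos V r))

  occ-block : ∀ T' r v → occ (suc (suc v)) (block T' r) ≡ occ (suc v) (rowAt T' r) + occ (suc (suc v))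
      (suc (suc r) ∷ [])
  occ-block T' r v = trans (occ-reverse _ (liftedRow T' r)) (occ-liftRow v (d r) (rowAt T' r) (suc (suc r)))

  occ-1-liftedReading : ∀ {m'} T' → SmallFilling m' T' → μ⊆L → ∀ r → occ 1 (liftedReading T' r) ≡ a ∸ s r
  occ-1-liftedReading T' V sub zero = trans (occ-++ 1 (replicate (a ∸ s 0) 1) [])
      (trans (+-identityʳ _) (occ-replicate 1 (a ∸ s 0) 1))
  occ-1-liftedReading T' V sub (suc r) = begin
      occ 1 (replicate (a ∸ s 0) 1 ++ (concatUpTo (block T') r ++ block T' r))
        ≡⟨ cong (occ 1) (sym (++-assoc (replicate (a ∸ s 0) 1) (concatUpTo (block T') r) (block T' r))) ⟩
      occ 1 (liftedReading T' r ++ block T' r) ≡⟨ occ-++ 1 (liftedReading T' r) (block T' r) ⟩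
      occ 1 (liftedReading T' r) + occ 1 (block T' r)
        ≡⟨ cong₂ _+_ (occ-1-liftedReading T' V sub r) (occ-1-block T' V r) ⟩
      (a ∸ s r) + d r ≡⟨ ∸-telescope (μ-decreasing r) (≤-trans (μ-antitone z≤n) (μ[0]≤a sub)) ⟩
      a ∸ s (suc r) ∎
    where open ≡-Reasoning

  liftedReading-suc : ∀ T' r → liftedReading T' (suc r) ≡ liftedReading T' r ++ block T' r
  liftedReading-suc T' r = sym (++-assoc (replicate (a ∸ s 0) 1) (concatUpTo (block T') r) (block T' r))

  occ-reading-≥ : ∀ {m'} T' → SmallFilling m' T' → ∀ r v → r ≤ v → occ (suc v) (reading T' r) ≡ 0
  occ-reading-≥ T' V r v le = occ-concatUpTo-≡0 (suc v) (reverse ∘ rowAt T') r (λ i lt →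
    All-reverse (rowAt T' i) (All.map (λ x≤ → s≤s (≤-trans x≤ (≤-trans lt le))) (SmallFilling.rb V i)))

  occ-liftedReading-≥ : ∀ {m'} T' → SmallFilling m' T' → ∀ r v → r ≤ v → occ (suc (suc v)) (liftedReading T' r) ≡ 0
  occ-liftedReading-≥ T' V zero v le = trans (occ-++ _ (replicate (a ∸ s 0) 1) [])
      (trans (cong (_+ 0) (occ-replicate _ (a ∸ s 0) 1)) refl)
  occ-liftedReading-≥ T' V (suc r) v le = begin
      occ (suc (suc v)) (liftedReading T' (suc r)) ≡⟨ cong (occ (suc (suc v))) (liftedReading-suc T' r) ⟩
      occ (suc (suc v)) (liftedReading T' r ++ block T' r) ≡⟨ occ-++ _ (liftedReading T' r) (block T' r) ⟩
      occ (suc (suc v)) (liftedReading T' r) + occ (suc (suc v)) (block T' r)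
        ≡⟨ cong₂ _+_ (occ-liftedReading-≥ T' V r v (≤-trans (n≤1+n r) le)) (occ-block T' r v) ⟩
      occ (suc v) (rowAt T' r) + occ (suc (suc v)) (suc (suc r) ∷ [])
        ≡⟨ cong₂ _+_ z1 (occ-singleton-≢ v r (λ e → <-irrefl (sym e) le)) ⟩
      0 ∎
    where
    open ≡-Reasoning
    z1 : occ (suc v) (rowAt T' r) ≡ 0
    z1 = occ-≡0 (suc v) (rowAt T' r)
        (All.map (λ x≤ e → <-irrefl (sym e) (s≤s (≤-trans x≤ le))) (SmallFilling.rb V r))

  occ-liftedReading-< : ∀ {m'} T' → SmallFilling m' T' → ∀ r v → v < r → occ (suc (suc v)) (liftedReading T' r) ≡
      suc
      (occ (suc v) (reading T' r))
  occ-liftedReading-< T' V (suc r) v lt with m≤n⇒m<n∨m≡n (≤-pred lt)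
  ... | inj₁ lt' = begin
      occ (suc (suc v)) (liftedReading T' (suc r)) ≡⟨ cong (occ (suc (suc v))) (liftedReading-suc T' r) ⟩
      occ (suc (suc v)) (liftedReading T' r ++ block T' r) ≡⟨ occ-++ _ (liftedReading T' r) (block T' r) ⟩
      occ (suc (suc v)) (liftedReading T' r) + occ (suc (suc v)) (block T' r)
        ≡⟨ cong₂ _+_ (occ-liftedReading-< T' V r v lt') (occ-block T' r v) ⟩
      suc (occ (suc v) (reading T' r)) + (occ (suc v) (rowAt T' r) + occ (suc (suc v)) (suc (suc r) ∷ []))

          ≡⟨ cong (λ z → suc (occ (suc v) (reading T' r)) + (occ (suc v) (rowAt T' r) + z)) (occ-singleton-≢ v r (λ e → <-irrefl e lt')) ⟩
      suc (occ (suc v) (reading T' r)) + (occ (suc v) (rowAt T' r) + 0)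
        ≡⟨ cong (λ z → suc (occ (suc v) (reading T' r) + z)) (+-identityʳ _) ⟩
      suc (occ (suc v) (reading T' r) + occ (suc v) (rowAt T' r))
        ≡⟨ cong suc (sym (trans (occ-++ (suc v) (reading T' r) _) (cong (occ (suc v) (reading T' r) +_) (occ-reverse (suc v) (rowAt T' r))))) ⟩
      suc (occ (suc v) (reading T' (suc r))) ∎
    where open ≡-Reasoning
  ... | inj₂ refl = begin
      occ (suc (suc v)) (liftedReading T' (suc v)) ≡⟨ cong (occ (suc (suc v))) (liftedReading-suc T' v) ⟩
      occ (suc (suc v)) (liftedReading T' v ++ block T' v) ≡⟨ occ-++ _ (liftedReading T' v) (block T' v) ⟩
      occ (suc (suc v)) (liftedReading T' v) + occ (suc (suc v)) (block T' v)
        ≡⟨ cong₂ _+_ (occ-liftedReading-≥ T' V v v ≤-refl) (occ-block T' v v) ⟩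
      occ (suc v) (rowAt T' v) + occ (suc (suc v)) (suc (suc v) ∷ [])
        ≡⟨ cong (occ (suc v) (rowAt T' v) +_) (occ-singleton-≡ v) ⟩
      occ (suc v) (rowAt T' v) + 1 ≡⟨ +-comm _ 1 ⟩
      suc (occ (suc v) (rowAt T' v))
        ≡⟨ cong suc (sym (trans (occ-++ (suc v) (reading T' v) _) (cong₂ _+_ (occ-reading-≥ T' V v v ≤-refl) (occ-reverse (suc v) (rowAt T' v))))) ⟩
      suc (occ (suc v) (reading T' (suc v))) ∎
    where open ≡-Reasoning

  at-pad : ∀ xs v → v < n → at (pad n xs) v ≡ at xs v
  at-pad xs v lt = trans (cong (λ z → at z v) (map-applyUpTo (λ x → x) (at xs) n)) (at-applyUpTo (at xs) n v lt)

  length-pad : ∀ xs → length (pad n xs) ≡ n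
  length-pad xs = length-map-upTo (at xs) n

  bigν : List ℕ → List ℕ
  bigν ν̄ = a ∷ map suc (pad n ν̄)

  length-bigν : ∀ ν̄ → length (bigν ν̄) ≡ suc n
  length-bigν ν̄ = cong suc (trans (length-map suc (pad n ν̄)) (length-pad ν̄))

  at-bigν : ∀ ν̄ v → v < n → at (bigν ν̄) (suc v) ≡ suc (at ν̄ v)
  at-bigν ν̄ v lt = trans (at-map-suc (pad n ν̄) v (subst (v <_) (sym (length-pad ν̄)) lt))
      (cong suc (at-pad ν̄ v lt))

  occ-reading-≥alphabet : ∀ {m'} T' → SmallFilling m' T' → ∀ v → m' ≤ v → occ (suc v) (reading T' n) ≡ 0
  occ-reading-≥alphabet T' V v le = occ-concatUpTo-≡0 (suc v) (reverse ∘ rowAt T') n (λ i lt →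
    All-reverse (rowAt T' i) (All.map (λ x≤ → s≤s (≤-trans x≤ le)) (SmallFilling.alph V i)))

  lift-content⁺ : ∀ ν̄ T' → length ν̄ ≤ n → SmallFilling (length ν̄) T' → μ⊆L → HasContent ν̄ (revReading T') →
      HasContent (bigν ν̄) (revReading (lift T'))
  lift-content⁺ ν̄ T' mle V sub C zero lt = trans (cong (occ 1) (revReading-lift T'))
      (trans (occ-1-liftedReading T' V sub n) (cong (a ∸_) (μ[n]≡0 sub)))
  lift-content⁺ ν̄ T' mle V sub C (suc v) lt = trans (cong (occ (suc (suc v))) (revReading-lift T'))
    (trans (occ-liftedReading-< T' V n v vlt) (trans (cong suc c-bigλ≡c) (sym (at-bigν ν̄ v vlt))))
    where
    vlt : v < n
    vlt = ≤-pred (subst (suc v <_) (length-bigν ν̄) lt)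
    c-bigλ≡c : occ (suc v) (reading T' n) ≡ at ν̄ v
    c-bigλ≡c with v <? length ν̄
    ... | yes vl = trans (cong (occ (suc v)) (sym (revReading-small T' V))) (C v vl)
    ... | no nvl = trans (occ-reading-≥alphabet T' V v (≮⇒≥ nvl)) (sym (at-≥length ν̄ v (≮⇒≥ nvl)))

  lift-content⁻ : ∀ {m''} ν̄ T' → length ν̄ ≤ n → SmallFilling m'' T' → μ⊆L → HasContent (bigν ν̄)
      (revReading (lift T')) → HasContent ν̄ (revReading T')
  lift-content⁻ ν̄ T' mle V sub C v vl = suc-injective
      (trans (sym (trans (cong (occ (suc (suc v))) (revReading-lift T')) (trans (occ-liftedReading-< T' V n v vlt)
      (cong suc (cong (occ (suc v)) (sym (revReading-small T' V)))))))
    (trans (C (suc v) (subst (suc v <_) (sym (length-bigν ν̄)) (s≤s vlt))) (at-bigν ν̄ v vlt)))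
    where
    vlt : v < n
    vlt = ≤-trans vl mle

  lift-content⇒alphabet : ∀ ν̄ T' → length ν̄ ≤ n → SmallFilling n T' → μ⊆L → HasContent (bigν ν̄)
      (revReading (lift T')) → ∀ r → All (_≤ length ν̄) (rowAt T' r)
  lift-content⇒alphabet ν̄ T' mle V sub C r = All.tabulate each
    where
    open import Data.List.Membership.Propositional using (_∈_)
    each : ∀ {x} → x ∈ rowAt T' r → x ≤ length ν̄
    each {x} xin with x ≤? length ν̄
    ... | yes le = le
    ... | no nle = ⊥-elim (n≮0 (≤-trans pos1 (subst (occ x (reverse (rowAt T' r)) ≤_) z0 ge)))
      where
      rlt : r < n
      rlt with r <? n
      ... | yes lt = lt
      ... | no nlt = ⊥-elim
          (noMem (subst (x ∈_) (rowAt-≥length T' r (subst (_≤ r) (sym (SmallFilling.len V)) (≮⇒≥ nlt))) xin))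
        where
        noMem : x ∈ [] → ⊥
        noMem ()
      x1 : 1 ≤ x
      x1 = All.lookup (SmallFilling.pos V r) xin
      xn : x ≤ n
      xn = All.lookup (SmallFilling.alph V r) xin
      v = pred x
      xv : x ≡ suc v
      xv = sym (suc-pred x {{>-nonZero x1}})
      vlt : v < n
      vlt = subst (_≤ n) xv xn
      mv : length ν̄ ≤ v
      mv = ≤-pred (subst (length ν̄ <_) xv (≰⇒> nle))
      z0 : occ x (reading T' n) ≡ 0
      z0 = subst (λ z → occ z (reading T' n) ≡ 0) (sym xv)
          (suc-injective (trans (sym (occ-liftedReading-< T' V n v vlt))
        (trans (cong (occ (suc (suc v))) (sym (revReading-lift T')))
        (trans (C (suc v) (subst (suc v <_) (sym (length-bigν ν̄)) (s≤s vlt)))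
            (trans (at-bigν ν̄ v vlt) (cong suc (at-≥length ν̄ v mv)))))))
      ge : occ x (reverse (rowAt T' r)) ≤ occ x (reading T' n)
      ge = occ≤occ-concatUpTo x (reverse ∘ rowAt T') r n rlt
      pos1 : 1 ≤ occ x (reverse (rowAt T' r))
      pos1 = subst (1 ≤_) (sym (occ-reverse x (rowAt T' r))) (∈⇒1≤occ x (rowAt T' r) xin)

  liftedPartial : List (List ℕ) → ℕ → List ℕ → List ℕ
  liftedPartial T' r q = liftedReading T' r ++ (suc (suc r) ∷ map suc q)

  partial : List (List ℕ) → ℕ → List ℕ → List ℕ
  partial T' r q = reading T' r ++ q

  occ-1-liftedPartial : ∀ {m'} T' → SmallFilling m' T' → μ⊆L → ∀ r q → All (1 ≤_) q → occ 1
      (liftedPartial T' r q) ≡ a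
      ∸ s r
  occ-1-liftedPartial T' V sub r q qp = trans (occ-++ 1 (liftedReading T' r) _)
      (trans (cong₂ _+_ (occ-1-liftedReading T' V sub r) (trans (occ-map-suc 0 q) (occ-0-positive q qp)))
      (+-identityʳ _))

  occ-liftedPartial-≤ : ∀ {m'} T' → SmallFilling m' T' → ∀ r q v → v ≤ r → occ (suc (suc v))
      (liftedPartial T' r q) ≡
      suc (occ (suc v) (partial T' r q))
  occ-liftedPartial-≤ T' V r q v le with m≤n⇒m<n∨m≡n le
  ... | inj₁ lt = trans (occ-++ _ (liftedReading T' r) _)
      (trans (cong₂ _+_ (occ-liftedReading-< T' V r v lt)
      (trans (occ-mark-∷ v r q) (cong (_+ occ (suc v) q) (occ-singleton-≢ v r (λ e → <-irrefl e lt)))))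
      (cong suc (sym (occ-++ (suc v) (reading T' r) q))))
  ... | inj₂ refl = trans (occ-++ _ (liftedReading T' v) _)
      (trans (cong₂ _+_ (occ-liftedReading-≥ T' V v v ≤-refl)
      (trans (occ-mark-∷ v v q) (cong (_+ occ (suc v) q) (occ-singleton-≡ v))))
      (cong suc (sym (trans (occ-++ (suc v) (reading T' v) q)
          (cong (_+ occ (suc v) q) (occ-reading-≥ T' V v v ≤-refl))))))

  occ-liftedPartial-> : ∀ {m'} T' → SmallFilling m' T' → ∀ r q v → All (_≤ suc r) q → r < v → occ (suc (suc v))
      (liftedPartial T' r q) ≡ 0
  occ-liftedPartial-> T' V r q v qb lt = trans (occ-++ _ (liftedReading T' r) _)
      (cong₂ _+_ (occ-liftedReading-≥ T' V r v (<⇒≤ lt))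
    (trans (occ-mark-∷ v r q)
        (cong₂ _+_ (occ-singleton-≢ v r (λ e → <-irrefl (sym e) lt)) (occ-row-bounded r q v qb lt))))

  occ-partial-> : ∀ {m'} T' → SmallFilling m' T' → ∀ r q v → All (_≤ suc r) q → r < v → occ (suc v)
      (partial T' r q) ≡ 0
  occ-partial-> T' V r q v qb lt = trans (occ-++ _ (reading T' r) q)
      (cong₂ _+_ (occ-reading-≥ T' V r v (<⇒≤ lt)) (occ-row-bounded r q v qb lt))

  occ-partial-≥alphabet : ∀ {m'} T' → SmallFilling m' T' → ∀ r q k → All (_≤ m') q → m' ≤ k → occ (suc (suc k))
      (partial T' r q) ≡ 0
  occ-partial-≥alphabet T' V r q k qa le = trans (occ-++ _ (reading T' r) q) (cong₂ _+_
    (occ-concatUpTo-≡0 (suc (suc k)) (reverse ∘ rowAt T') r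
        (λ i lt → All-reverse (rowAt T' i)
        (All.map (λ x≤ → s≤s (≤-trans x≤ (≤-trans le (n≤1+n k)))) (SmallFilling.alph V i))))
    (occ-≡0 _ q (All.map (λ x≤ e → <-irrefl (sym e) (s≤s (≤-trans x≤ (≤-trans le (n≤1+n k))))) qa)))

  ones-in-reading-bound : ∀ {m'} T' → SmallFilling m' T' → μ⊆L → ColumnStrict T' μ → All Sorted T' → ∀ r → r < n →
      occ
      1 (reading T' (suc r)) + s r ≤ at L 0
  ones-in-reading-bound T' V sub C S zero lt = subst (_≤ at L 0) (sym (cong (_+ s 0) (occ-reverse 1 (rowAt T' 0))))
    (≤-trans (+-monoˡ-≤ (s 0)
        (subst (occ 1 (rowAt T' 0) ≤_) (SmallFilling.rlen V 0 lt) (occ≤length 1 (rowAt T' 0))))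
        (≤-reflexive (m∸n+n≡m (sub 0))))
  ones-in-reading-bound T' V sub C S (suc r) lt = begin
      occ 1 (reading T' (suc r) ++ reverse w) + s (suc r)
        ≡⟨ cong (_+ s (suc r)) (trans (occ-++ 1 (reading T' (suc r)) _) (cong (occ 1 (reading T' (suc r)) +_) (occ-reverse 1 w))) ⟩
      occ 1 (reading T' (suc r)) + o + s (suc r) ≡⟨ +-assoc (occ 1 (reading T' (suc r))) o (s (suc r)) ⟩
      occ 1 (reading T' (suc r)) + (o + s (suc r))
        ≤⟨ +-monoʳ-≤ (occ 1 (reading T' (suc r))) (subst (_≤ s r) (+-comm (s (suc r)) o) ob) ⟩
      occ 1 (reading T' (suc r)) + s r ≤⟨ ones-in-reading-bound T' V sub C S r (≤-trans (n≤1+n _) lt) ⟩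
      at L 0 ∎
    where
    open ≤-Reasoning
    w = rowAt T' (suc r)
    w0 = rowAt T' r
    o = occ 1 w
    rlt : r < n
    rlt = ≤-trans (n≤1+n _) lt
    sw : Sorted w
    sw = All-rowAt⁻ T' S (suc r) (subst (suc r <_) (sym (SmallFilling.len V)) lt)
    split = ones-split w sw (SmallFilling.pos V (suc r))
    ones : ∀ i → i < o → at w i ≡ 1
    ones i ilt = trans (cong (λ z → at z i) (proj₁ (proj₂ split)))
      (trans (at-++ˡ (replicate o 1) _ i (subst (i <_) (sym (length-replicate o)) ilt)) (at-replicate o 1 i ilt))
    lens : s (suc r) + length w ≤ s r + length w0
    lens = subst₂ _≤_ (sym
        (trans (cong (s (suc r) +_) (SmallFilling.rlen V (suc r) lt)) (m+[n∸m]≡n (sub (suc r)))))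
      (sym (trans (cong (s r +_) (SmallFilling.rlen V r rlt)) (m+[n∸m]≡n (sub r)))) (L-decreasing r)
    ob : s (suc r) + o ≤ s r
    ob = leading-ones-bound w0 (s r) w (s (suc r)) o (μ-decreasing r) lens (SmallFilling.pos V r) (occ≤length 1 w)
        ones
        (C r)

  -- For k ≤ r the lifted prefix holds one more letter k + 2 (the last cell of row k + 1) than the small
  -- prefix holds k + 1, so letters ≥ 3 inherit their balance from the small word, while 2s against 1s
  -- needs the bound on the 1s of the small word.
  balanced-liftedPartial⁺ : ∀ {m'} T' → SmallFilling m' T' → μ⊆L → m' ≤ n → ∀ r q → r < n → All (1 ≤_) q →
      All (_≤ suc r) q → All (_≤ m') q →
    occ 1 (partial T' r q) + s r ≤ at L 0 → Balanced m' (partial T' r q) → Balanced (suc n) (liftedPartial T' r q)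
  balanced-liftedPartial⁺ T' V sub mn r q rlt qp qb qa ob G zero _ = subst₂ _≤_
      (sym (occ-liftedPartial-≤ T' V r q 0 z≤n)) (sym (occ-1-liftedPartial T' V sub r q qp))
    (m+n≤o⇒m≤o∸n (suc (occ 1 (partial T' r q))) (≤-trans (s≤s ob) L[0]<a))
  balanced-liftedPartial⁺ {m'} T' V sub mn r q rlt qp qb qa ob G (suc k) klt with suc k ≤? r
  ... | yes le = subst₂ _≤_ (sym (occ-liftedPartial-≤ T' V r q (suc k) le))
      (sym (occ-liftedPartial-≤ T' V r q k (≤-trans (n≤1+n k) le))) (s≤s inner)
    where
    inner : occ (suc (suc k)) (partial T' r q) ≤ occ (suc k) (partial T' r q)
    inner with k <? m'
    ... | yes km = G k km
    ... | no nkm = subst (_≤ occ (suc k) (partial T' r q)) (sym (occ-partial-≥alphabet T' V r q k qa (≮⇒≥ nkm)))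
        z≤n
  ... | no nle = subst (_≤ occ (suc (suc k)) (liftedPartial T' r q))
      (sym (occ-liftedPartial-> T' V r q (suc k) qb (≰⇒> nle))) z≤n

  balanced-liftedPartial⁻ : ∀ {m'} T' → SmallFilling m' T' → m' ≤ n → ∀ r q → All (_≤ suc r) q → Balanced (suc n)
      (liftedPartial T' r q) → Balanced m' (partial T' r q)
  balanced-liftedPartial⁻ T' V mn r q qb G k km with suc k ≤? r
  ... | yes le = ≤-pred
      (subst₂ _≤_ (occ-liftedPartial-≤ T' V r q (suc k) le)
      (occ-liftedPartial-≤ T' V r q k (≤-trans (n≤1+n k) le)) (G (suc k) (s≤s (≤-trans km mn))))
  ... | no nle = subst (_≤ occ (suc k) (partial T' r q)) (sym (occ-partial-> T' V r q (suc k) qb (≰⇒> nle))) z≤n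

  block-≡ : ∀ T' r → block T' r ≡ suc (suc r) ∷ (map suc (reverse (rowAt T' r)) ++ replicate (d r) 1)
  block-≡ T' r = reverse-liftRow (d r) (rowAt T' r) (suc (suc r))

  module LatticeTransfer {m'} (T' : List (List ℕ)) (V : SmallFilling m' T') (sub : μ⊆L) (mn : m' ≤ n) where

    block-lattice⁺ : ColumnStrict T' μ → All Sorted T' → ∀ r → r < n → Balanced (suc n) (liftedReading T' r) →
        LatticeAfter m' (reading T' r) (reverse (rowAt T' r)) →
      LatticeAfter (suc n) (liftedReading T' r) (block T' r)
    block-lattice⁺ C S r rlt G0 LA p s' e with p | trans e (block-≡ T' r)
    ... | [] | _ = subst (Balanced (suc n)) (sym (++-identityʳ (liftedReading T' r))) G0
    ... | y ∷ p₁ | e' with ∷-injective e'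
    ... | refl , e2 with ++-≡-++-cases p₁ s' (map suc u) (replicate (d r) 1) e2
      where u = reverse (rowAt T' r)
    ... | inj₁ (t , e3) with prefix-map-suc p₁ t (reverse (rowAt T' r)) e3
    ... | q , t' , refl , e4 = balanced-liftedPartial⁺ T' V sub mn r q rlt
           (All-prefix q t' _ e4 (All-reverse _ (SmallFilling.pos V r)))
               (All-prefix q t' _ e4 (All-reverse _ (SmallFilling.rb V r)))
           (All-prefix q t' _ e4 (All-reverse _ (SmallFilling.alph V r))) ob (LA q t' e4)
      where
      ob : occ 1 (partial T' r q) + s r ≤ at L 0
      ob = ≤-trans (+-monoˡ-≤ (s r) (subst (occ 1 (partial T' r q) ≤_) (cong (λ z → occ 1 (reading T' r ++ z)) e4)
             (subst₂ _≤_ (sym (occ-++ 1 (reading T' r) q))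
                 (sym (trans (occ-++ 1 (reading T' r) (q ++ t')) (cong (occ 1 (reading T' r) +_) (occ-++ 1 q t'))))
               (+-monoʳ-≤ (occ 1 (reading T' r)) (m≤m+n (occ 1 q) (occ 1 t'))))))
           (ones-in-reading-bound T' V sub C S r rlt)
    block-lattice⁺ C S r rlt G0 LA p s' e | y ∷ p₁ | e' | refl , e2 | inj₂ (p₂ , refl , e4) =
      subst (Balanced (suc n)) (++-assoc (liftedReading T' r) (suc (suc r) ∷ map suc (reverse (rowAt T' r))) p₂)
        (balanced-++-ones (suc n) (liftedPartial T' r (reverse (rowAt T' r))) p₂
            (All-prefix p₂ s' _ e4 (AP.replicate⁺ (d r) refl))
          (balanced-liftedPartial⁺ T' V sub mn r u rlt (All-reverse _ (SmallFilling.pos V r))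
              (All-reverse _ (SmallFilling.rb V r)) (All-reverse _ (SmallFilling.alph V r))
            (ones-in-reading-bound T' V sub C S r rlt)
            (LA u [] (++-identityʳ u))))
      where u = reverse (rowAt T' r)

    block-lattice⁻ : ∀ r → LatticeAfter (suc n) (liftedReading T' r) (block T' r) → LatticeAfter m' (reading T' r)
        (reverse (rowAt T' r))
    block-lattice⁻ r LA q t e = balanced-liftedPartial⁻ T' V mn r q
        (All-prefix q t _ e (All-reverse _ (SmallFilling.rb V r)))
      (LA (suc (suc r) ∷ map suc q) (map suc t ++ replicate (d r) 1) e'')
      where
      e'' : (suc (suc r) ∷ map suc q) ++ (map suc t ++ replicate (d r) 1) ≡ block T' r
      e'' = sym (trans (block-≡ T' r)
          (cong (suc (suc r) ∷_) (trans (cong (λ z → map suc z ++ replicate (d r) 1) (sym e))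
        (trans (cong (_++ replicate (d r) 1) (map-++ suc q t)) (++-assoc (map suc q) (map suc t) _)))))

    liftedReading-lattice⁺ : ColumnStrict T' μ → All Sorted T' → ∀ r → r ≤ n → LatticeWord m' (reading T' r) →
        LatticeWord (suc n) (liftedReading T' r)
    liftedReading-lattice⁺ C S zero le L' p s' e = balanced-ones (suc n) p
        (All-prefix p s' _ e (subst (All (_≡ 1)) (sym (++-identityʳ _)) (AP.replicate⁺ (a ∸ s 0) refl)))
    liftedReading-lattice⁺ C S (suc r) le L' = subst (LatticeWord (suc n)) (sym (liftedReading-suc T' r))
        (latticeAfter-++⁺ (suc n) [] (liftedReading T' r) (block T' r) IH
          (block-lattice⁺ C S r le (IH (liftedReading T' r) [] (++-identityʳ _)) (proj₂ sp)))
      where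
      sp = latticeAfter-++⁻ m' [] (reading T' r) (reverse (rowAt T' r)) L'
      IH = liftedReading-lattice⁺ C S r (≤-trans (n≤1+n r) le) (proj₁ sp)

    liftedReading-lattice⁻ : ∀ r → LatticeWord (suc n) (liftedReading T' r) → LatticeWord m' (reading T' r)
    liftedReading-lattice⁻ zero L0 [] s' e k lt = z≤n
    liftedReading-lattice⁻ (suc r) L0 = latticeAfter-++⁺ m' [] (reading T' r) (reverse (rowAt T' r))
        (liftedReading-lattice⁻ r (proj₁ sp)) (block-lattice⁻ r (proj₂ sp))
      where
      sp = latticeAfter-++⁻ (suc n) [] (liftedReading T' r) (block T' r)
          (subst (LatticeWord (suc n)) (liftedReading-suc T' r) L0)

  bigλ : List ℕ
  bigλ = a ∷ map suc L

  length-bigλ : length bigλ ≡ suc n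
  length-bigλ = cong suc (trans (length-map suc L) length-L)

  at-bigλ : ∀ r → r < n → at bigλ (suc r) ≡ suc (at L r)
  at-bigλ r lt = at-map-suc L r (subst (r <_) (sym length-L) lt)

  bigλ-decreasing : ∀ r → r < n → at bigλ (suc r) ≤ at bigλ r
  bigλ-decreasing zero lt = subst (_≤ a) (sym (at-bigλ 0 lt)) L[0]<a
  bigλ-decreasing (suc r) lt = subst₂ _≤_ (sym (at-bigλ (suc r) lt)) (sym (at-bigλ r (≤-trans (n≤1+n _) lt)))
      (s≤s (L-decreasing r))

  module Unlifting (ν̄ : List ℕ) (mle : length ν̄ ≤ n) (T : List (List ℕ)) (PF : Filling (suc n) bigλ μ T)
    (μlam : ∀ i → s i ≤ at bigλ i) (LR : IsLRTableau μ (bigν ν̄) T) where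

    lenT : length T ≡ suc n
    lenT = trans (Filling.len PF) length-bigλ

    alphT : ∀ r → All (_≤ suc n) (rowAt T r)
    alphT r = All.map proj₂ (Filling.ent PF r)

    posT : ∀ r → All (1 ≤_) (rowAt T r)
    posT r = All.map proj₁ (Filling.ent PF r)

    latT : LatticeWord (suc n) (revReading T)
    latT = subst (λ z → LatticeWord z (revReading T)) (length-bigν ν̄) (IsLRTableau.lattice-word LR)

    open LatticeRowBound (suc n) T (IsLRTableau.rows-sorted LR) alphT latT using (row-entries-≤)

    F = reverse ∘ rowAt T

    RT : revReading T ≡ concatUpTo F (suc n)
    RT = trans (revReading≡concatUpTo T) (cong (concatUpTo F) lenT)

    srtT : ∀ r → r < suc n → Sorted (rowAt T r)
    srtT r lt = All-rowAt⁻ T (IsLRTableau.rows-sorted LR) r (subst (r <_) (sym lenT) lt)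

    rlenT : ∀ r → r < suc n → length (rowAt T r) ≡ at bigλ r ∸ s r
    rlenT r lt = Filling.rlen PF r (subst (r <_) (sym length-bigλ) lt)

    first-row-ones : rowAt T 0 ≡ replicate (a ∸ s 0) 1
    first-row-ones = trans (all≡1⇒replicate _ (All-zip (row-entries-≤ 0) (posT 0) ≤-antisym))
             (cong (λ z → replicate z 1) (rlenT 0 (s≤s z≤n)))

    occ-rows-below : ∀ r v → r ≤ v → occ (suc v) (concatUpTo F r) ≡ 0
    occ-rows-below r v rv = occ-concatUpTo-≡0 (suc v) F r
        (λ i lt → All-reverse _ (All.map (λ le → s≤s (≤-trans le (≤-trans lt rv))) (row-entries-≤ i)))

    row-ends-with-mark : ∀ r → r < n → 1 ≤ occ (suc (suc r)) (rowAt T (suc r)) →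
      ∃ λ w₀ → rowAt T (suc r) ≡ w₀ ++ suc (suc r) ∷ []
    row-ends-with-mark r rlt pos with rowAt T (suc r) in eqw
    ... | [] = ⊥-elim (n≮0 pos)
    ... | x ∷ xs with snoc-view (x ∷ xs) (λ ())
    ... | w₀ , y , e = w₀ , trans e (cong (λ z → w₀ ++ z ∷ []) (≤-antisym yle gey))
      where
      rb' : All (_≤ suc (suc r)) (w₀ ++ y ∷ [])
      rb' = subst (All _) e (subst (All _) eqw (row-entries-≤ (suc r)))
      yle : y ≤ suc (suc r)
      yle with AP.++⁻ʳ w₀ rb'
      ... | le ∷ [] = le
      srt' : Sorted (w₀ ++ y ∷ [])
      srt' = subst Sorted e (subst Sorted eqw (srtT (suc r) (s≤s rlt)))
      gey : suc (suc r) ≤ y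
      gey = All.lookup (AP.++⁺ (sorted-∷ʳ⁻ w₀ y srt') (≤-refl ∷ []))
          (1≤occ⇒∈ _ _ (subst (λ z → 1 ≤ occ (suc (suc r)) z) e pos))

    -- Downward induction on r: row r + 1 ends with r + 2, and the lattice condition at that letter
    -- needs an earlier r + 1, which can only lie in row r.
    row-contains-mark : ∀ k r → r + k ≡ n → 1 ≤ r → 1 ≤ occ (suc r) (rowAt T r)
    row-contains-mark zero r e one with m≤n⇒∃[o]m+o≡n (subst (1 ≤_) (trans (sym (+-identityʳ r)) e) one)
    ... | n' , en = subst (λ z → 1 ≤ occ (suc z) (rowAt T z)) (sym (trans (sym (+-identityʳ r)) e)) n-in-last-row
      where
      n'lt : n' < n
      n'lt = subst (n' <_) en ≤-refl
      c1 : occ (suc n) (concatUpTo F (suc n)) ≡ suc (at ν̄ n')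
      c1 = trans (cong (occ (suc n)) (sym RT))
          (trans (IsLRTableau.content LR n (subst (n <_) (sym (length-bigν ν̄)) ≤-refl))
             (trans (cong (at (bigν ν̄)) (sym en)) (at-bigν ν̄ n' n'lt)))
      c2 : occ (suc n) (concatUpTo F (suc n)) ≡ occ (suc n) (rowAt T n)
      c2 = trans (occ-++ (suc n) (concatUpTo F n) (F n))
          (cong₂ _+_ (occ-rows-below n n ≤-refl) (occ-reverse (suc n) (rowAt T n)))
      n-in-last-row : 1 ≤ occ (suc n) (rowAt T n)
      n-in-last-row = subst (1 ≤_) (trans (sym c1) c2) (s≤s z≤n)
    row-contains-mark (suc k) r e one = subst (1 ≤_) occ1p (≤-trans (subst (1 ≤_) (sym occ2p) (m≤n+m 1 _)) G)
      where
      e' : suc r + k ≡ n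
      e' = trans (sym (+-suc r k)) e
      rlt : r < n
      rlt = subst (r <_) e (subst (_≤ r + suc k) (+-identityʳ (suc r))
          (subst (suc r + 0 ≤_) (sym (+-suc r k)) (s≤s (+-monoʳ-≤ r z≤n))))
      IH = row-contains-mark k (suc r) e' (s≤s z≤n)
      lw = row-ends-with-mark r rlt IH
      w₀ = proj₁ lw
      sp = concatUpTo-split F (suc r) (suc n) (s≤s rlt)
      rest = proj₁ sp
      p = concatUpTo F (suc r) ++ suc (suc r) ∷ []
      revw : F (suc r) ≡ suc (suc r) ∷ reverse w₀
      revw = trans (cong reverse (proj₂ lw)) (reverse-++ w₀ (suc (suc r) ∷ []))
      pe : p ++ (reverse w₀ ++ rest) ≡ revReading T
      pe = sym (trans RT (trans (proj₂ sp) (trans (cong (λ z → concatUpTo F (suc r) ++ z ++ rest) revw)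
             (sym (++-assoc (concatUpTo F (suc r)) (suc (suc r) ∷ []) (reverse w₀ ++ rest))))))
      G = latT p (reverse w₀ ++ rest) pe r (s≤s (<⇒≤ rlt))
      occ2p : occ (suc (suc r)) p ≡ occ (suc (suc r)) (concatUpTo F (suc r)) + 1
      occ2p = trans (occ-++ _ (concatUpTo F (suc r)) (suc (suc r) ∷ []))
          (cong (occ (suc (suc r)) (concatUpTo F (suc r)) +_) (occ-∷-≡ (suc (suc r)) []))
      occ1p : occ (suc r) p ≡ occ (suc r) (rowAt T r)
      occ1p = trans (occ-++ _ (concatUpTo F (suc r)) (suc (suc r) ∷ []))
        (trans (cong₂ _+_ (trans (occ-++ (suc r) (concatUpTo F r) (F r))
            (cong₂ _+_ (occ-rows-below r r ≤-refl) (occ-reverse (suc r) (rowAt T r))))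
                          (occ-∷-≢ {suc r} {suc (suc r)} [] (λ e → <-irrefl e (n<1+n _))))
          (+-identityʳ _))

    ones-per-row-bound : ∀ r → r < n → occ 1 (rowAt T (suc r)) + s (suc r) ≤ s r
    ones-per-row-bound r rlt = subst (_≤ s r) (+-comm (s (suc r)) _)
        (leading-ones-bound w0 (s r) w (s (suc r)) (occ 1 w) (μ-decreasing r) lens (posT r) (occ≤length 1 w) ones
        (IsLRTableau.columns-strict LR r))
      where
      w = rowAt T (suc r)
      w0 = rowAt T r
      split = ones-split w (srtT (suc r) (s≤s rlt)) (posT (suc r))
      ones : ∀ i → i < occ 1 w → at w i ≡ 1
      ones i ilt = trans (cong (λ z → at z i) (proj₁ (proj₂ split)))
        (trans (at-++ˡ (replicate (occ 1 w) 1) _ i (subst (i <_) (sym (length-replicate (occ 1 w))) ilt))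
            (at-replicate (occ 1 w) 1 i ilt))
      lens : s (suc r) + length w ≤ s r + length w0
      lens = subst₂ _≤_ (sym (trans (cong (s (suc r) +_) (rlenT (suc r) (s≤s rlt))) (m+[n∸m]≡n (μlam (suc r)))))
        (sym (trans (cong (s r +_) (rlenT r (≤-trans (n≤1+n _) (s≤s rlt)))) (m+[n∸m]≡n (μlam r))))
            (bigλ-decreasing r rlt)

    ones : ℕ → ℕ
    ones r = occ 1 (rowAt T (suc r))

    ones-total : (a ∸ s 0) + sumUpTo n ones ≡ a
    ones-total = trans (sym e1)
        (trans (cong (occ 1) (sym RT)) (IsLRTableau.content LR 0 (subst (0 <_) (sym (length-bigν ν̄)) (s≤s z≤n))))
      where
      e1 : occ 1 (concatUpTo F (suc n)) ≡ (a ∸ s 0) + sumUpTo n ones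
      e1 = trans (cong (occ 1) (concatUpTo-suc F n)) (trans (occ-++ 1 (F 0) _) (cong₂ _+_
        (trans (occ-reverse 1 (rowAt T 0)) (trans (cong (occ 1) first-row-ones) (occ-replicate 1 (a ∸ s 0) 1)))
        (trans (occ-concatUpTo 1 (F ∘ suc) n) (sumUpTo-cong n _ _ (λ i _ → occ-reverse 1 (rowAt T (suc i)))))))

    ones-sum : sumUpTo n ones ≡ s 0
    ones-sum = +-cancelˡ-≡ (a ∸ s 0) _ _
        (trans ones-total (sym (trans (+-comm (a ∸ s 0) (s 0)) (m+[n∸m]≡n (μlam 0)))))

    -- Row 0 holds a ∸ μ₀ ones and column strictness allows at most μ_r ∸ μ_{r+1} in row r + 1; as the
    -- content asks for a ones in total, all these bounds are attained.
    ones-tight : ∀ r → r < n → ones r + s (suc r) ≡ s r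
    ones-tight = telescope-tight s ones n ones-per-row-bound (subst (_≤ sumUpTo n ones + s n) ones-sum (m≤m+n _ _))

    μ[n]≡0′ : s n ≡ 0
    μ[n]≡0′ = n≤0⇒n≡0 (+-cancelˡ-≤ (s 0) _ _
        (subst (_≤ s 0 + 0) (cong (_+ s n) ones-sum)
        (subst (sumUpTo n ones + s n ≤_) (sym (+-identityʳ (s 0))) (telescope-bound s ones n ones-per-row-bound))))

    record LiftedRowShape (r : ℕ) : Set where
      field
        u : List ℕ
        req : rowAt T (suc r) ≡ liftRow (d r) u (suc (suc r))
        upos : All (1 ≤_) u
        urb : All (_≤ suc r) u
        ulen : length u ≡ at L r ∸ s r
        sle : s r ≤ at L r

    row-split : ∀ r → r < n → ∃ λ mid →
      rowAt T (suc r) ≡ replicate (d r) 1 ++ mid ++ suc (suc r) ∷ [] × All (2 ≤_) mid × All (_≤ suc (suc r)) mid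
    row-split r rlt = mid , row≡ , mid2 , midb
      where
      lw = row-ends-with-mark r rlt (row-contains-mark (n ∸ suc r) (suc r) (m+[n∸m]≡n rlt) (s≤s z≤n))
      w₀ = proj₁ lw
      top = suc (suc r)
      sw : Sorted (w₀ ++ top ∷ [])
      sw = subst Sorted (proj₂ lw) (srtT (suc r) (s≤s rlt))
      os = ones-split w₀ (proj₁ (sorted-++⁻ w₀ sw)) (AP.++⁻ˡ w₀ (subst (All _) (proj₂ lw) (posT (suc r))))
      mid = proj₁ os
      o = occ 1 w₀
      w₀eq : w₀ ≡ replicate o 1 ++ mid
      w₀eq = proj₁ (proj₂ os)
      mid2 : All (2 ≤_) mid
      mid2 = proj₂ (proj₂ os)
      midb : All (_≤ top) mid
      midb = AP.++⁻ʳ (replicate o 1)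
          (subst (All _) w₀eq (AP.++⁻ˡ w₀ (subst (All _) (proj₂ lw) (row-entries-≤ (suc r)))))
      o≡d : o ≡ d r
      o≡d = begin
        o
          ≡⟨ trans (cong (occ 1) (proj₂ lw)) (trans (occ-++ 1 w₀ (top ∷ [])) (+-identityʳ _)) ⟨
        ones r                         ≡⟨ m+n∸n≡m (ones r) (s (suc r)) ⟨
        ones r + s (suc r) ∸ s (suc r) ≡⟨ cong (_∸ s (suc r)) (ones-tight r rlt) ⟩
        d r                            ∎
        where open ≡-Reasoning
      row≡ : rowAt T (suc r) ≡ replicate (d r) 1 ++ mid ++ top ∷ []
      row≡ = trans (proj₂ lw) (trans (cong (_++ top ∷ []) w₀eq)
        (trans (++-assoc (replicate o 1) mid (top ∷ [])) (cong (λ x → replicate x 1 ++ mid ++ top ∷ []) o≡d)))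

    lifted-row-length : ∀ r → r < n → ∀ u → rowAt T (suc r) ≡ liftRow (d r) u (suc (suc r)) → at L r ≡ s r +
        length u
    lifted-row-length r rlt u row≡ = suc-injective (begin
      suc (at L r)                             ≡⟨ m+[n∸m]≡n (subst (s (suc r) ≤_) (at-bigλ r rlt) (μlam (suc r))) ⟨
      s (suc r) + (suc (at L r) ∸ s (suc r))   ≡⟨ cong (s (suc r) +_) length-row ⟨
      s (suc r) + length (rowAt T (suc r))     ≡⟨ cong (λ w → s (suc r) + length w) row≡ ⟩
      s (suc r) + length (liftRow (d r) u _)   ≡⟨ cong (s (suc r) +_) (length-liftRow (d r) u _) ⟩
      s (suc r) + (d r + suc (length u))       ≡⟨ +-assoc (s (suc r)) (d r) _ ⟨
      s (suc r) + d r + suc (length u)         ≡⟨ cong (_+ suc (length u)) (μ-split r) ⟨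
      s r + suc (length u)                     ≡⟨ +-suc (s r) (length u) ⟩
      suc (s r + length u)                     ∎)
      where
      open ≡-Reasoning
      length-row : length (rowAt T (suc r)) ≡ suc (at L r) ∸ s (suc r)
      length-row = trans (rlenT (suc r) (s≤s rlt)) (cong (_∸ s (suc r)) (at-bigλ r rlt))

    liftedRowShape : ∀ r → r < n → LiftedRowShape r
    liftedRowShape r rlt with row-split r rlt
    ... | mid , row≡ , mid2 , midb = record
      { u = map pred mid ; req = req ; upos = AP.map⁺ (All.map (λ { (s≤s le) → le }) mid2)
      ; urb = AP.map⁺ (All.map pred-mono-≤ midb)
      ; ulen = sym (trans (cong (_∸ s r) L≡) (m+n∸m≡n (s r) _))
      ; sle = subst (s r ≤_) (sym L≡) (m≤m+n _ _) }
      where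
      req : rowAt T (suc r) ≡ liftRow (d r) (map pred mid) (suc (suc r))
      req = trans row≡ (cong (λ y → replicate (d r) 1 ++ y ++ suc (suc r) ∷ [])
        (sym (map-suc-pred mid (All.map (≤-trans (s≤s z≤n)) mid2))))
      L≡ = lifted-row-length r rlt (map pred mid) req

    T̄ : List (List ℕ)
    T̄ = unlift T

    rowAt-small : ∀ r → (rlt : r < n) → rowAt T̄ r ≡ LiftedRowShape.u (liftedRowShape r rlt)
    rowAt-small r rlt = trans (rowAt-map-upTo _ n r rlt)
        (trans (cong (unliftRow r) (LiftedRowShape.req (liftedRowShape r rlt))) (unliftRow-liftRow r _ _))

    rowAt-small-≥ : ∀ r → n ≤ r → rowAt T̄ r ≡ []
    rowAt-small-≥ r le = rowAt-map-upTo-≥ _ n r le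

    onSmallRows : ∀ {P : ℕ → List ℕ → Set} → (∀ r → P r []) →
        (∀ r → (rlt : r < n) → P r (LiftedRowShape.u (liftedRowShape r rlt))) → ∀ r → P r (rowAt T̄ r)
    onSmallRows {P} p0 h' r with r <? n
    ... | yes rlt = subst (P r) (sym (rowAt-small r rlt)) (h' r rlt)
    ... | no nlt = subst (P r) (sym (rowAt-small-≥ r (≮⇒≥ nlt))) (p0 r)

    small-valid : SmallFilling n T̄
    small-valid = record
      { len = length-map-upTo _ n
      ; rlen = λ r rlt → trans (cong length (rowAt-small r rlt)) (LiftedRowShape.ulen (liftedRowShape r rlt))
      ; pos = onSmallRows {λ _ → All (1 ≤_)} (λ _ → []) (λ r rlt → LiftedRowShape.upos (liftedRowShape r rlt))
      ; rb = onSmallRows {λ r → All (_≤ suc r)} (λ _ → []) (λ r rlt → LiftedRowShape.urb (liftedRowShape r rlt))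
      ; alph = onSmallRows {λ _ → All (_≤ n)} (λ _ → [])
          (λ r rlt → All.map (λ le → ≤-trans le rlt) (LiftedRowShape.urb (liftedRowShape r rlt))) }

    small-μ⊆L : μ⊆L
    small-μ⊆L i with i <? n
    ... | yes lt = LiftedRowShape.sle (liftedRowShape i lt)
    ... | no nlt = subst (_≤ at L i) (sym (n≤0⇒n≡0 (subst (s i ≤_) μ[n]≡0′ (μ-antitone (≮⇒≥ nlt))))) z≤n

    T≡lift-small : T ≡ lift T̄
    T≡lift-small = trans (rows-∷ T n lenT) (cong₂ _∷_ first-row-ones (map-upTo-cong _ _ n (λ r rlt →
      trans (LiftedRowShape.req (liftedRowShape r rlt))
          (cong (λ z → liftRow (d r) z (suc (suc r))) (sym (rowAt-small r rlt))))))

  lift-isLR⁺ : ∀ ν̄ T' → SmallFilling (length ν̄) T' → μ⊆L → length ν̄ ≤ n → IsLRTableau μ ν̄ T' → IsLRTableau μ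
      (bigν ν̄) (lift T')
  lift-isLR⁺ ν̄ T' V sub mn R = record
    { rows-sorted = lift-sorted⁺ T' V (IsLRTableau.rows-sorted R)
    ; columns-strict = lift-columnStrict⁺ T' V sub (IsLRTableau.columns-strict R)
    ; content = lift-content⁺ ν̄ T' mn V sub (IsLRTableau.content R)
    ; lattice-word = subst (λ z → LatticeWord z (revReading (lift T'))) (sym (length-bigν ν̄))
        (subst (LatticeWord (suc n)) (sym (revReading-lift T'))
        (LatticeTransfer.liftedReading-lattice⁺ T' V sub mn (IsLRTableau.columns-strict R)
            (IsLRTableau.rows-sorted R)
            n ≤-refl (subst (LatticeWord (length ν̄)) (revReading-small T' V) (IsLRTableau.lattice-word R)))) }

  lift-isLR⁻ : ∀ ν̄ T' → SmallFilling (length ν̄) T' → μ⊆L → length ν̄ ≤ n → IsLRTableau μ (bigν ν̄) (lift T') →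
      IsLRTableau μ ν̄ T'
  lift-isLR⁻ ν̄ T' V sub mn R = record
    { rows-sorted = lift-sorted⁻ T' V (IsLRTableau.rows-sorted R)
    ; columns-strict = lift-columnStrict⁻ T' V sub (IsLRTableau.columns-strict R)
    ; content = lift-content⁻ ν̄ T' mn V sub (IsLRTableau.content R)
    ; lattice-word = subst (LatticeWord (length ν̄)) (sym (revReading-small T' V))
        (LatticeTransfer.liftedReading-lattice⁻ T' V sub mn n
        (subst (LatticeWord (suc n)) (revReading-lift T')
            (subst (λ z → LatticeWord z (revReading (lift T'))) (length-bigν ν̄) (IsLRTableau.lattice-word R)))) }

  lift-filling : ∀ {m'} T' → SmallFilling m' T' → m' ≤ n → μ⊆L → Filling (suc n) bigλ μ (lift T')
  lift-filling T' V mn sub = record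
    { len = trans (length-lift T') (sym length-bigλ)
    ; rlen = rl
    ; ent = en }
    where
    rl : ∀ r → r < length bigλ → length (rowAt (lift T') r) ≡ at bigλ r ∸ s r
    rl zero _ = length-replicate (a ∸ s 0)
    rl (suc r) lt = trans (cong length (rowAt-lift T' r rlt)) (trans (length-liftRow (d r) (rowAt T' r) _)
        (trans (cong (λ z → d r + suc z) (SmallFilling.rlen V r rlt)) (trans (+-suc (d r) _)
        (trans (cong suc (trans (+-comm (d r) _) (∸-telescope (μ-decreasing r) (sub r))))
            (trans (sym (+-∸-assoc 1 (≤-trans (μ-decreasing r) (sub r))))
        (cong (_∸ s (suc r)) (sym (at-bigλ r rlt))))))))
      where
      rlt : r < n
      rlt = ≤-pred (subst (suc r <_) length-bigλ lt)
    en : ∀ r → All (Letter (suc n)) (rowAt (lift T') r)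
    en zero = AP.replicate⁺ (a ∸ s 0) (≤-refl , s≤s z≤n)
    en (suc r) with r <? n
    ... | no nlt = subst (All _) (sym (rowAt-lift-≥ T' r (≮⇒≥ nlt))) []
    ... | yes rlt = subst (All _) (sym (rowAt-lift T' r rlt)) (AP.++⁺ (AP.replicate⁺ (d r) (≤-refl , s≤s z≤n))
        (AP.++⁺ (AP.map⁺ (All.map (λ le → s≤s z≤n , s≤s (≤-trans le mn)) (SmallFilling.alph V r)))
            ((s≤s z≤n , s≤s rlt) ∷ [])))


module Correspondence (n a : ℕ) (λ̄ ν̄ μ : List ℕ) (λ̄-short : length λ̄ ≤ n) (ν̄-short : length ν̄ ≤ n)
  (μ-decreasing : ∀ i → at μ (suc i) ≤ at μ i) (λ̄-decreasing : ∀ i → at λ̄ (suc i) ≤ at λ̄ i)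
  (L[0]<a : suc (at (pad n λ̄) 0) ≤ a) where
  L : List ℕ
  L = pad n λ̄

  at-L : ∀ i → at L i ≡ at λ̄ i
  at-L i with i <? n
  ... | yes lt = trans (cong (λ z → at z i) (map-applyUpTo (λ x → x) (at λ̄) n)) (at-applyUpTo (at λ̄) n i lt)
  ... | no nlt = trans (cong (λ z → at z i) (map-applyUpTo (λ x → x) (at λ̄) n))
     (trans (at-applyUpTo-≥ (at λ̄) n i (≮⇒≥ nlt)) (sym (at-≥length λ̄ i (≤-trans λ̄-short (≮⇒≥ nlt)))))

  length-L : length L ≡ n
  length-L = length-map-upTo (at λ̄) n

  L-decreasing : ∀ i → at L (suc i) ≤ at L i
  L-decreasing i = subst₂ _≤_ (sym (at-L (suc i))) (sym (at-L i)) (λ̄-decreasing i)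

  open Lifting n a L μ length-L μ-decreasing L-decreasing L[0]<a

  padRows : List (List ℕ) → List (List ℕ)
  padRows Y = Y ++ replicate (n ∸ length Y) []

  length-padRows : ∀ Y → length Y ≤ n → length (padRows Y) ≡ n
  length-padRows Y le = trans (length-++ Y)
      (trans (cong (length Y +_) (length-replicate (n ∸ length Y))) (m+[n∸m]≡n le))

  rowAt-padRows : ∀ Y r → rowAt (padRows Y) r ≡ rowAt Y r
  rowAt-padRows Y r = rowAt-++-nil Y (n ∸ length Y) r

  lift-cong : ∀ Y Z → (∀ r → rowAt Y r ≡ rowAt Z r) → lift Y ≡ lift Z
  lift-cong Y Z e = cong (replicate (a ∸ s 0) 1 ∷_)
      (map-upTo-cong _ _ n (λ r _ → cong (λ z → liftRow (d r) z (suc (suc r))) (e r)))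

  padRows-small : ∀ {m'} Y → Filling m' λ̄ μ Y → All Sorted Y → LatticeWord m' (revReading Y) → SmallFilling m'
      (padRows Y)
  padRows-small {m'} Y PF S Lt = record
    { len = length-padRows Y (subst (_≤ n) (sym (Filling.len PF)) λ̄-short)
    ; rlen = rl
    ; pos = λ r → subst (All _) (sym (rowAt-padRows Y r)) (All.map proj₁ (Filling.ent PF r))
    ; rb = λ r → subst (All _) (sym (rowAt-padRows Y r))
        (LatticeRowBound.row-entries-≤ m' Y S (λ r → All.map proj₂ (Filling.ent PF r)) Lt r)
    ; alph = λ r → subst (All _) (sym (rowAt-padRows Y r)) (All.map proj₂ (Filling.ent PF r)) }
    where
    rl : ∀ r → r < n → length (rowAt (padRows Y) r) ≡ at L r ∸ s r
    rl r lt with r <? length λ̄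
    ... | yes rl' = trans (cong length (rowAt-padRows Y r))
        (trans (Filling.rlen PF r rl') (cong (_∸ s r) (sym (at-L r))))
    ... | no nrl = trans (cong length
        (trans (rowAt-padRows Y r) (rowAt-≥length Y r (subst (_≤ r) (sym (Filling.len PF)) (≮⇒≥ nrl)))))
        (sym (trans (cong (_∸ s r) (trans (at-L r) (at-≥length λ̄ r (≮⇒≥ nrl)))) (0∸n≡0 (s r))))

  rowAt-take-small : ∀ {m'} Y → SmallFilling m' Y → ∀ r → rowAt (take (length λ̄) Y) r ≡ rowAt Y r
  rowAt-take-small Y V r with r <? length λ̄
  ... | yes lt = rowAt-take (length λ̄) Y r lt
  ... | no nlt = trans (rowAt-take-≥ (length λ̄) Y r (≮⇒≥ nlt)) (sym emp)
    where
    emp : rowAt Y r ≡ []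
    emp with r <? n
    ... | no nlt2 = rowAt-≥length Y r (subst (_≤ r) (sym (SmallFilling.len V)) (≮⇒≥ nlt2))
    ... | yes lt2 = length≡0⇒[] _
        (trans (SmallFilling.rlen V r lt2)
        (trans (cong (_∸ s r) (trans (at-L r) (at-≥length λ̄ r (≮⇒≥ nlt)))) (0∸n≡0 (s r))))

  take-filling : ∀ {m'} Y → SmallFilling m' Y → Filling m' λ̄ μ (take (length λ̄) Y)
  take-filling Y V = record
    { len = length-take-≤ (length λ̄) Y (subst (length λ̄ ≤_) (sym (SmallFilling.len V)) λ̄-short)
    ; rlen = λ r lt → trans (cong length (rowAt-take-small Y V r))
        (trans (SmallFilling.rlen V r (≤-trans lt λ̄-short)) (cong (_∸ s r) (at-L r)))
    ; ent = λ r → subst (All _) (sym (rowAt-take-small Y V r))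
        (allz (SmallFilling.pos V r) (SmallFilling.alph V r)) }
    where
    allz : ∀ {m' w} → All (1 ≤_) w → All (_≤ m') w → All (Letter m') w
    allz [] [] = []
    allz (p ∷ a) (q ∷ b) = (p , q) ∷ allz a b

  μ⊆L-of : T (μ ⊆ᵇ λ̄) → μ⊆L
  μ⊆L-of t i = subst (s i ≤_) (sym (at-L i)) (⊆ᵇ⇒≤ μ λ̄ t i)

  μ⊆bigλ : T (μ ⊆ᵇ λ̄) → T (μ ⊆ᵇ bigλ)
  μ⊆bigλ t = ≤⇒⊆ᵇ μ bigλ pt
    where
    sub = μ⊆L-of t
    pt : ∀ i → at μ i ≤ at bigλ i
    pt zero = ≤-trans (sub 0) (≤-trans (n≤1+n _) L[0]<a)
    pt (suc j) with j <? n
    ... | yes lt = subst (at μ (suc j) ≤_) (sym (at-bigλ j lt))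
        (≤-trans (μ-decreasing j) (≤-trans (sub j) (n≤1+n _)))
    ... | no nlt = subst (_≤ at bigλ (suc j))
        (sym (n≤0⇒n≡0 (subst (at μ (suc j) ≤_)
        (at-≥length λ̄ (suc j) (≤-trans λ̄-short (≤-trans (≮⇒≥ nlt) (n≤1+n j)))) (⊆ᵇ⇒≤ μ λ̄ t (suc j))))) z≤n

  unlift′ : List (List ℕ) → List (List ℕ)
  unlift′ Y = take (length λ̄) (unlift Y)

  ν⁺ = bigν ν̄

  bigFillings = fillings (length ν⁺) bigλ μ
  smallFillings = fillings (length ν̄) λ̄ μ

  filling-of : ∀ {Y} → Y ∈ bigFillings → Filling (suc n) bigλ μ Y
  filling-of {Y} Y∈ = subst (λ m → Filling m bigλ μ Y) (length-bigν ν̄)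
      (RowWords⇒Filling (∈-fillings⁻ (length ν⁺) bigλ μ Y∈))

  unlift-correct : T (μ ⊆ᵇ bigλ) → ∀ {Y} → Y ∈ bigFillings → T (isLR μ ν⁺ Y) →
    unlift′ Y ∈ smallFillings × T (isLR μ ν̄ (unlift′ Y)) × lift (unlift′ Y) ≡ Y
  unlift-correct μ⊆ {Y} Y∈ lrY =
      ∈-fillings⁺ (length ν̄) λ̄ μ (Filling⇒RowWords _ _ _ _ (take-filling Ȳ Ȳ-small))
    , Equivalence.from (T-isLR μ ν̄ _)
        (IsLRTableau-cong μ ν̄ Ȳ (unlift′ Y) (λ r → sym (rowAt-take-small Ȳ Ȳ-small r)) Ȳ-LR)
    , trans (lift-cong (unlift′ Y) Ȳ (rowAt-take-small Ȳ Ȳ-small)) (sym U.T≡lift-small)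
    where
    module U = Unlifting ν̄ ν̄-short Y (filling-of Y∈) (⊆ᵇ⇒≤ μ bigλ μ⊆) (Equivalence.to (T-isLR μ ν⁺ Y) lrY)
    Ȳ = U.T̄
    lift-LR : IsLRTableau μ ν⁺ (lift Ȳ)
    lift-LR = subst (IsLRTableau μ ν⁺) U.T≡lift-small (Equivalence.to (T-isLR μ ν⁺ Y) lrY)
    Ȳ-small : SmallFilling (length ν̄) Ȳ
    Ȳ-small = record
      { len = SmallFilling.len U.small-valid ; rlen = SmallFilling.rlen U.small-valid
      ; pos = SmallFilling.pos U.small-valid ; rb = SmallFilling.rb U.small-valid
      ; alph = lift-content⇒alphabet ν̄ Ȳ ν̄-short U.small-valid U.small-μ⊆L (IsLRTableau.content lift-LR) }
    Ȳ-LR = lift-isLR⁻ ν̄ Ȳ Ȳ-small U.small-μ⊆L ν̄-short lift-LR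

  lift-correct : T (μ ⊆ᵇ λ̄) → ∀ {Y} → Y ∈ smallFillings → T (isLR μ ν̄ Y) →
    lift Y ∈ bigFillings × T (isLR μ ν⁺ (lift Y)) × unlift′ (lift Y) ≡ Y
  lift-correct μ⊆ {Y} Y∈ lrY =
      subst (_∈ bigFillings) (sym lift-pad) (∈-fillings⁺ (length ν⁺) bigλ μ (Filling⇒RowWords _ _ _ _
        (subst (λ m → Filling m bigλ μ (lift (padRows Y))) (sym (length-bigν ν̄))
            (lift-filling (padRows Y) Y-small ν̄-short inside))))
    , Equivalence.from (T-isLR μ ν⁺ (lift Y))
        (subst (IsLRTableau μ ν⁺) (sym lift-pad) (lift-isLR⁺ ν̄ (padRows Y) Y-small inside ν̄-short padded-LR))
    , (begin
        take (length λ̄) (unlift (lift Y))            ≡⟨ cong (take (length λ̄) ∘ unlift) lift-pad ⟩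
        take (length λ̄) (unlift (lift (padRows Y)))  ≡⟨ cong (take (length λ̄)) (unlift-lift (padRows Y) Y-small) ⟩
        take (length λ̄) (padRows Y)
          ≡⟨ cong (λ k → take k (padRows Y)) (sym (Filling.len Y-filling)) ⟩
        take (length Y) (padRows Y)                  ≡⟨ take-++ Y _ ⟩
        Y                                            ∎)
    where
    open ≡-Reasoning
    Y-filling = RowWords⇒Filling (∈-fillings⁻ (length ν̄) λ̄ μ Y∈)
    Y-LR = Equivalence.to (T-isLR μ ν̄ Y) lrY
    inside = μ⊆L-of μ⊆
    Y-small = padRows-small Y Y-filling (IsLRTableau.rows-sorted Y-LR) (IsLRTableau.lattice-word Y-LR)
    padded-LR = IsLRTableau-cong μ ν̄ Y (padRows Y) (λ r → sym (rowAt-padRows Y r)) Y-LR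
    lift-pad : lift Y ≡ lift (padRows Y)
    lift-pad = lift-cong Y (padRows Y) (λ r → sym (rowAt-padRows Y r))

  LR-shape⇒μ⊆λ̄ : T (μ ⊆ᵇ bigλ) → ∀ {Y} → Y ∈ bigFillings → T (isLR μ ν⁺ Y) → T (μ ⊆ᵇ λ̄)
  LR-shape⇒μ⊆λ̄ μ⊆ {Y} Y∈ lrY = ≤⇒⊆ᵇ μ λ̄ λ i → subst (at μ i ≤_) (at-L i)
    (Unlifting.small-μ⊆L ν̄ ν̄-short Y (filling-of Y∈) (⊆ᵇ⇒≤ μ bigλ μ⊆) (Equivalence.to (T-isLR μ ν⁺ Y) lrY) i)

  c-bigλ≡c : c bigλ μ ν⁺ ≡ c λ̄ μ ν̄
  c-bigλ≡c with μ ⊆ᵇ λ̄ in μ⊆λ̄ | μ ⊆ᵇ bigλ in μ⊆bigλ′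
  ... | false | false = refl
  ... | true | false = ⊥-elim (subst T μ⊆bigλ′ (μ⊆bigλ (Equivalence.from T-≡ μ⊆λ̄)))
  ... | false | true = countᵇ-none (isLR μ ν⁺) bigFillings
    (λ Y∈ lrY → subst T μ⊆λ̄ (LR-shape⇒μ⊆λ̄ (Equivalence.from T-≡ μ⊆bigλ′) Y∈ lrY))
  ... | true | true = countᵇ-bijection (isLR μ ν⁺) (isLR μ ν̄) lift unlift′
    (fillings-unique (length ν⁺) bigλ μ) (fillings-unique (length ν̄) λ̄ μ)
    (lift-correct (Equivalence.from T-≡ μ⊆λ̄)) (unlift-correct (Equivalence.from T-≡ μ⊆bigλ′))


IsPartition⇒decreasing : ∀ xs → IsPartition xs → ∀ i → at xs (suc i) ≤ at xs i
IsPartition⇒decreasing [] p i = z≤n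
IsPartition⇒decreasing (x ∷ []) p zero = z≤n
IsPartition⇒decreasing (x ∷ []) p (suc i) = z≤n
IsPartition⇒decreasing (x ∷ y ∷ xs) (_ ∷ pos , y≤x ∷ dec) zero = y≤x
IsPartition⇒decreasing (x ∷ y ∷ xs) (_ ∷ pos , y≤x ∷ dec) (suc i) = IsPartition⇒decreasing (y ∷ xs) (pos , dec) i

IsPartition-∷-map-suc⇒< : ∀ a xs → IsPartition (a ∷ map suc xs) → at xs 0 < a
IsPartition-∷-map-suc⇒< a [] (1≤a ∷ _ , _) = 1≤a
IsPartition-∷-map-suc⇒< a (x ∷ xs) (_ , x<a ∷ _) = x<a

lemma4p1 : (λ' ν λ̄ ν̄ : List ℕ) → IsPartition λ' → IsPartition ν → IsPartition λ̄ → IsPartition ν̄ →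
  (a : ℕ) → length λ̄ ≤ ℓ λ' ∸ 1 → length ν̄ ≤ ℓ λ' ∸ 1 →
  ν ≡ a ∷ map suc (pad (ℓ λ' ∸ 1) ν̄) →
  λ' ≡ a ∷ map suc (pad (ℓ λ' ∸ 1) λ̄) →
  (μ : List ℕ) → IsPartition μ → c λ' μ ν ≡ c λ̄ μ ν̄
lemma4p1 λ' ν λ̄ ν̄ λ'-partition _ λ̄-partition _ a λ̄-short ν̄-short ν≡ λ'≡ μ μ-partition =
  trans (cong₂ (λ λ′ ν′ → c λ′ μ ν′) λ'≡ ν≡)
    (Correspondence.c-bigλ≡c (ℓ λ' ∸ 1) a λ̄ ν̄ μ λ̄-short ν̄-short
      (IsPartition⇒decreasing μ μ-partition) (IsPartition⇒decreasing λ̄ λ̄-partition)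
      (IsPartition-∷-map-suc⇒< a (pad (ℓ λ' ∸ 1) λ̄) (subst IsPartition λ'≡ λ'-partition)))
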